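{- Let $G$ be a finite simple connected graph which is periodic (in the sense defined in the context). If all the eigenvalues of the transition matrix $T(G)$ are rational numbers, then $\mathrm{diam}(G) < 5$.
   Context: For a finite simple graph $G=(V,E)$, let $\mathcal{A}(G)=\{(u,v),(v,u) : uv\in E\}$ be its set of symmetric arcs; for an arc $e=(u,v)$ write $o(e)=u$, $t(e)=v$ and $e^{ -1}=(v,u)$. The Grover transfer matrix $U=U(G)$ is the matrix indexed by $\mathcal{A}(G)$ with entries $U_{e,f}=2/\deg(t(f))$ if $t(f)=o(e)$ and $e\neq f^{ -1}$; $U_{e,f}=2/\deg(t(f))-1$ if $e=f^{ -1}$; and $U_{e,f}=0$ otherwise. The graph $G$ is called periodic if there is a positive integer $k$ with $U^k=I$ (the identity on $\ell^2(\mathcal{A}(G))$). The transition matrix $T=T(G)$ of simple random walk is indexed by $V$ with $T_{u,v}=1/\deg(u)$ if $u\sim v$ and $0$ otherwise. $\mathrm{diam}(G)$ is the maximum graph distance between two vertices. -}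

module Defs where

open import Data.Bool using (Bool; true; false; if_then_else_; _∧_)
open import Data.Nat using (ℕ; zero; suc; _<_)
open import Data.Fin using (Fin; zero; suc; punchIn; toℕ)
open import Data.Fin.Properties using () renaming (_≟_ to _≟ᶠ_)
open import Data.Integer using (+_)
open import Data.Rational using (ℚ; 0ℚ; 1ℚ; _/_) renaming (_+_ to _+ℚ_; _*_ to _*ℚ_; -_ to -ℚ_; _-_ to _-ℚ_)
open import Data.List using (List; []; _∷_; allFin; concatMap; map; filter; foldr)
open import Data.Vec using (Vec; []; _∷_)
open import Data.Product using (_×_; _,_; ∃; proj₁; proj₂)
open import Relation.Nullary using (¬_; does)
open import Relation.Binary.PropositionalEquality using (_≡_)

record Graph : Set where
  field
    n     : ℕ
    adj   : Fin n → Fin n → Bool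
    sym   : ∀ u v → adj u v ≡ adj v u
    irrefl : ∀ u → adj u u ≡ false
open Graph public

deg : (G : Graph) → Fin (n G) → ℕ
deg G u = foldr (λ v k → if adj G u v then suc k else k) 0 (allFin (n G))

-- 1 / d as a rational (only ever used with d ≥ 1; 1/0 := 0 is a dummy)
inv : ℕ → ℚ
inv zero    = 0ℚ
inv (suc d) = + 1 / suc d

data Walk (G : Graph) : Fin (n G) → Fin (n G) → ℕ → Set where
  nil  : ∀ {u} → Walk G u u 0
  cons : ∀ {u v w k} → adj G u v ≡ true → Walk G v w k → Walk G u w (suc k)

Connected : Graph → Set
Connected G = ∀ u v → ∃ λ k → Walk G u v k

DiamLessThan : Graph → ℕ → Set
DiamLessThan G m = ∀ u v → ∃ λ k → k < m × Walk G u v k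

Pair : Graph → Set
Pair G = Fin (n G) × Fin (n G)

IsArc : (G : Graph) → Pair G → Set
IsArc G (u , v) = adj G u v ≡ true

arcs : (G : Graph) → List (Pair G)
arcs G = filter (λ e → Data.Bool._≟_ (adj G (proj₁ e) (proj₂ e)) true)
           (concatMap (λ u → map (λ v → (u , v)) (allFin (n G))) (allFin (n G)))
  where import Data.Bool

-- matrices indexed by arcs (given on pairs; only arc entries matter)
ArcMatrix : Graph → Set
ArcMatrix G = Pair G → Pair G → ℚ

sumOver : ∀ {A : Set} → List A → (A → ℚ) → ℚ
sumOver xs f = foldr (λ x s → f x +ℚ s) 0ℚ xs

mulArc : (G : Graph) → ArcMatrix G → ArcMatrix G → ArcMatrix G
mulArc G A B e f = sumOver (arcs G) (λ g → A e g *ℚ B g f)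

eqᶠ : ∀ {m} → Fin m → Fin m → Bool
eqᶠ i j = does (i ≟ᶠ j)

idArc : (G : Graph) → ArcMatrix G
idArc G (a , b) (c , d) = if eqᶠ a c ∧ eqᶠ b d then 1ℚ else 0ℚ

-- U_{e,f} for e = (a,b), f = (c,d):  o(e)=a, t(f)=d, e = f⁻¹ iff (a,b)=(d,c)
grover : (G : Graph) → ArcMatrix G
grover G (a , b) (c , d) =
  if eqᶠ d a
  then (if eqᶠ b c then (+ 2 / 1) *ℚ inv (deg G d) -ℚ 1ℚ
                   else (+ 2 / 1) *ℚ inv (deg G d))
  else 0ℚ

powArc : (G : Graph) → ArcMatrix G → ℕ → ArcMatrix G
powArc G A zero    = idArc G
powArc G A (suc k) = mulArc G A (powArc G A k)

Periodic : Graph → Set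
Periodic G = ∃ λ k → ∀ (e f : Pair G) → IsArc G e → IsArc G f →
  powArc G (grover G) (suc k) e f ≡ idArc G e f

transition : (G : Graph) → Fin (n G) → Fin (n G) → ℚ
transition G u v = if adj G u v then inv (deg G u) else 0ℚ

-- Polynomials over ℚ (coefficient lists, constant term first)

Poly : Set
Poly = List ℚ

_⊕_ : Poly → Poly → Poly
[]       ⊕ q        = q
p        ⊕ []       = p
(a ∷ p)  ⊕ (b ∷ q)  = (a +ℚ b) ∷ (p ⊕ q)

scale : ℚ → Poly → Poly
scale c = map (c *ℚ_)

_⊗_ : Poly → Poly → Poly
[]      ⊗ q = []
(a ∷ p) ⊗ q = scale a q ⊕ (0ℚ ∷ (p ⊗ q))

negP : Poly → Poly
negP = scale (-ℚ 1ℚ)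

constP : ℚ → Poly
constP c = c ∷ []

X : Poly
X = 0ℚ ∷ 1ℚ ∷ []

coeff : Poly → ℕ → ℚ
coeff []      _       = 0ℚ
coeff (a ∷ p) zero    = a
coeff (a ∷ p) (suc i) = coeff p i

-- equality of polynomials (coefficientwise, ignoring trailing zeros)
_≈P_ : Poly → Poly → Set
p ≈P q = ∀ i → coeff p i ≡ coeff q i

isEven : ℕ → Bool
isEven zero    = true
isEven (suc k) = Data.Bool.not (isEven k)
  where import Data.Bool

det : ∀ {m} → (Fin m → Fin m → Poly) → Poly
det {zero}  M = constP 1ℚ
det {suc m} M = go (allFin (suc m))
  where
    sign : Fin (suc m) → Poly
    sign j = constP (if isEven (toℕ j) then 1ℚ else -ℚ 1ℚ)
    minor : Fin (suc m) → Fin m → Fin m → Poly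
    minor j i k = M (suc i) (punchIn j k)
    go : List (Fin (suc m)) → Poly
    go []       = []
    go (j ∷ js) = ((sign j ⊗ M zero j) ⊗ det (minor j)) ⊕ go js

charPoly : ∀ {m} → (Fin m → Fin m → ℚ) → Poly
charPoly A = det (λ i j → (if eqᶠ i j then X else []) ⊕ constP (-ℚ A i j))

prodLinear : ∀ {m} → Vec ℚ m → Poly
prodLinear []       = constP 1ℚ
prodLinear (λ₀ ∷ λs) = (X ⊕ constP (-ℚ λ₀)) ⊗ prodLinear λs

-- all eigenvalues of A are rational: the characteristic polynomial
-- splits into linear factors over ℚ (its roots, with multiplicity)
AllEigenvaluesRational : ∀ {m} → (Fin m → Fin m → ℚ) → Set
AllEigenvaluesRational {m} A = ∃ λ (λs : Vec ℚ m) → charPoly A ≈P prodLinear λs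

-- An arc function ψ(a, b) = α(b) + β(a) is mapped by the Grover matrix U to a function of the same
-- shape, with (α, β) ↦ (−β, α + 2Tβ). Starting from (x, 0), periodicity U^K = I thus gives
-- T_K(T) = I for the Chebyshev polynomial T_K, so every eigenvalue μ of T satisfies V_K(2μ) = 2,
-- where V_k(2 cos θ) = 2 cos kθ is the Lucas sequence. For rational 2μ = p/q in lowest terms,
-- q^k V_k(p/q) ≡ p^k (mod q) forces q = 1, and then 2μ ∈ {0, ±1, ±2} (Niven). Since T is
-- self-adjoint for the degree-weighted inner product and is annihilated by its characteristic
-- polynomial (Cayley–Hamilton), which splits over ℚ, it is annihilated by x(x² − ¼)(x² − 1).
-- So T⁵ is a combination of T and T³; as (Tᵐ e_v)(u) > 0 exactly when some walk of length m
-- joins u to v, a walk from u to v of length m forces one of length below 5.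

module Submission where

open import Algebra.Bundles using (CommutativeRing)
open import Data.Bool using (Bool; true; false; if_then_else_)
import Data.Bool as Bool
open import Data.Empty using (⊥-elim)
open import Data.Fin using (Fin; zero; suc; punchIn; toℕ; lift)
open import Data.Fin.Permutation.Components using (transpose)
open import Data.Fin.Properties using (any?; toℕ<n) renaming (_≟_ to _≟ᶠ_)
open import Data.Integer as ℤ using (ℤ)
import Data.Integer.Properties as ℤₚ
open import Data.Integer.Divisibility.Signed using (divides; ∣⇒∣ᵤ) renaming (_∣_ to _∣ℤ_)
open import Data.Integer.Tactic.RingSolver using (solve-∀)
open import Data.List using (List; []; _∷_; _++_; map; concatMap; filter; allFin; tabulate; foldr; length; lookup)
open import Data.Nat as ℕ using (ℕ; zero; suc; z≤n; s≤s)
import Data.Nat.Properties as ℕₚ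
open import Data.Nat.Coprimality using (Coprime; 1-coprimeTo; coprime-divisor; recompute) renaming (sym to coprime-sym)
open import Data.Nat.Divisibility using (∣1⇒≡1) renaming (_∣_ to _∣ℕ_)
open import Data.Product using (_×_; _,_; proj₁; proj₂; ∃)
open import Data.Rational
  using ( ℚ; mkℚ; 0ℚ; 1ℚ; ½; _+_; _*_; -_; _-_; _/_; 1/_; _≤_; _<_; _<?_; _≤?_; ↥_; *<*
        ; NonZero; ≢-nonZero; positive; nonNegative; nonPositive)
open import Data.Rational.Properties
open import Data.Rational.Solver using (module +-*-Solver)
import Data.Rational.Unnormalised as ℚᵘ
import Data.Rational.Unnormalised.Properties as ℚᵘₚ
open import Data.Sum using (_⊎_; inj₁; inj₂)
open import Data.Vec using (Vec; []; _∷_)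
open import Function using (_∘_)
open import Relation.Binary.PropositionalEquality
open import Relation.Nullary using (Dec; yes; no; ¬?)
open import Relation.Nullary.Decidable using (from-yes; dec-false; decidable-stable)
open import Algebra.Properties.Group +-0-group using () renaming (⁻¹-involutive to neg-involutive)
open import Algebra.Properties.Ring +-*-ring using (-1*x≈-x)
open import Algebra.Properties.Semiring.Sum (CommutativeRing.semiring +-*-commutativeRing)
  using (sum; sum-syntax; sum-cong-≗; ∑-distrib-+; ∑-comm; *-distribˡ-sum; *-distribʳ-sum; sum-replicate-zero; sum-remove)

open import Defs renaming (sym to adj-sym)
open +-*-Solver

-- Finite sums and ℚ arithmetic

Matrix : ℕ → Set
Matrix n = Fin n → Fin n → ℚ

∑-zero : ∀ n → ∑[ i < n ] 0ℚ ≡ 0ℚ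
∑-zero n = sum-replicate-zero n

∑-*ˡ : ∀ {n} c (f : Fin n → ℚ) → ∑[ i < n ] (c * f i) ≡ c * sum f
∑-*ˡ c f = sym (*-distribˡ-sum c f)

∑-*ʳ : ∀ {n} c (f : Fin n → ℚ) → ∑[ i < n ] (f i * c) ≡ sum f * c
∑-*ʳ c f = sym (*-distribʳ-sum c f)

∑-neg : ∀ {n} (f : Fin n → ℚ) → ∑[ i < n ] (- f i) ≡ - sum f
∑-neg {zero} f = refl
∑-neg {suc n} f = trans (cong (- f zero +_) (∑-neg (f ∘ suc))) (sym (neg-distrib-+ (f zero) _))

eqᶠ-refl : ∀ {n} (i : Fin n) → eqᶠ i i ≡ true
eqᶠ-refl zero = refl
eqᶠ-refl (suc i) = eqᶠ-refl i

eqᶠ⇒≡ : ∀ {n} {i j : Fin n} → eqᶠ i j ≡ true → i ≡ j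
eqᶠ⇒≡ {i = i} {j} e with i ≟ᶠ j
... | yes i≡j = i≡j

δ : ∀ {n} → Fin n → Fin n → ℚ
δ i j = if eqᶠ i j then 1ℚ else 0ℚ

∑-δˡ : ∀ {n} (i : Fin n) (f : Fin n → ℚ) → ∑[ j < n ] (δ i j * f j) ≡ f i
∑-δˡ {suc n} zero f =
  trans (cong₂ _+_ (*-identityˡ (f zero)) (trans (sum-cong-≗ λ j → *-zeroˡ (f (suc j))) (∑-zero n))) (+-identityʳ (f zero))
∑-δˡ {suc n} (suc i) f = trans (cong₂ _+_ (*-zeroˡ (f zero)) (∑-δˡ i (f ∘ suc))) (+-identityˡ (f (suc i)))

δ-comm : ∀ {n} (i j : Fin n) → δ i j ≡ δ j i
δ-comm zero zero = refl
δ-comm zero (suc j) = refl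
δ-comm (suc i) zero = refl
δ-comm (suc i) (suc j) = δ-comm i j

∑-δʳ : ∀ {n} (i : Fin n) (f : Fin n → ℚ) → ∑[ j < n ] (δ j i * f j) ≡ f i
∑-δʳ i f = trans (sum-cong-≗ λ j → cong (_* f j) (δ-comm j i)) (∑-δˡ i f)

∑-nonNeg : ∀ {n} (f : Fin n → ℚ) → (∀ i → 0ℚ ≤ f i) → 0ℚ ≤ sum f
∑-nonNeg {zero} f f≥0 = ≤-refl
∑-nonNeg {suc n} f f≥0 = +-mono-≤ (f≥0 zero) (∑-nonNeg (f ∘ suc) (f≥0 ∘ suc))

term≤∑ : ∀ {n} (f : Fin n → ℚ) → (∀ i → 0ℚ ≤ f i) → ∀ i → f i ≤ sum f
term≤∑ {suc n} f f≥0 i = begin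
  f i                        ≡⟨ +-identityʳ (f i) ⟨
  f i + 0ℚ                   ≤⟨ +-monoʳ-≤ (f i) (∑-nonNeg (f ∘ punchIn i) (f≥0 ∘ punchIn i)) ⟩
  f i + sum (f ∘ punchIn i)  ≡⟨ sum-remove f ⟨
  sum f                      ∎
  where open ≤-Reasoning

∑-nonNeg-≡0 : ∀ {n} (f : Fin n → ℚ) → (∀ i → 0ℚ ≤ f i) → sum f ≡ 0ℚ → ∀ i → f i ≡ 0ℚ
∑-nonNeg-≡0 f f≥0 ∑f≡0 i = ≤-antisym (subst (f i ≤_) ∑f≡0 (term≤∑ f f≥0 i)) (f≥0 i)

∑≢0⇒∃≢0 : ∀ {n} (f : Fin n → ℚ) → sum f ≢ 0ℚ → ∃ λ i → f i ≢ 0ℚ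
∑≢0⇒∃≢0 {zero} f ∑f≢0 = ⊥-elim (∑f≢0 refl)
∑≢0⇒∃≢0 {suc n} f ∑f≢0 with f zero ≟ 0ℚ
... | no f₀≢0 = zero , f₀≢0
... | yes f₀≡0 with ∑≢0⇒∃≢0 (f ∘ suc) (λ ∑≡0 → ∑f≢0 (cong₂ _+_ f₀≡0 ∑≡0))
...   | i , fᵢ≢0 = suc i , fᵢ≢0

∑-if : ∀ {n} (a : Fin n) (f : Fin n → ℚ) → ∑[ i < n ] (if eqᶠ i a then f i else 0ℚ) ≡ f a
∑-if a f = trans (sum-cong-≗ sift) (∑-δʳ a f)
  where
  sift : ∀ i → (if eqᶠ i a then f i else 0ℚ) ≡ δ i a * f i
  sift i with eqᶠ i a
  ... | true = sym (*-identityˡ (f i))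
  ... | false = sym (*-zeroˡ (f i))

0<p*q : ∀ {p q} → 0ℚ < p → 0ℚ < q → 0ℚ < p * q
0<p*q {p} {q} 0<p 0<q = positive⁻¹ (p * q) {{pos*pos⇒pos p {{positive 0<p}} q {{positive 0<q}}}}

p<q⇒0<q-p : ∀ {p q} → p < q → 0ℚ < q - p
p<q⇒0<q-p {p} {q} p<q = subst (_< q - p) (+-inverseʳ p) (+-monoˡ-< (- p) p<q)

0<q-p⇒p<q : ∀ {p q} → 0ℚ < q - p → p < q
0<q-p⇒p<q {p} {q} 0<q-p = subst₂ _<_ (+-identityˡ p) (solve 2 (λ q p → (q :- p) :+ p := q) refl q p) (+-monoˡ-< p 0<q-p)

0≤p*q : ∀ {p q} → 0ℚ ≤ p → 0ℚ ≤ q → 0ℚ ≤ p * q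
0≤p*q {p} {q} 0≤p 0≤q = nonNegative⁻¹ (p * q) {{nonNeg*nonNeg⇒nonNeg p {{nonNegative 0≤p}} q {{nonNegative 0≤q}}}}

0≤p*p : ∀ p → 0ℚ ≤ p * p
0≤p*p p with ≤-total 0ℚ p
... | inj₁ 0≤p = 0≤p*q 0≤p 0≤p
... | inj₂ p≤0 = nonNegative⁻¹ (p * p) {{nonPos*nonPos⇒nonPos p {{nonPositive p≤0}} p {{nonPositive p≤0}}}}

*-cancelˡ-≡0 : ∀ x y → x ≢ 0ℚ → x * y ≡ 0ℚ → y ≡ 0ℚ
*-cancelˡ-≡0 x y x≢0 xy≡0 = begin
  y                ≡⟨ *-identityˡ y ⟨
  1ℚ * y           ≡⟨ cong (_* y) (*-inverseˡ x) ⟨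
  (1/ x) * x * y   ≡⟨ *-assoc (1/ x) x y ⟩
  (1/ x) * (x * y) ≡⟨ cong ((1/ x) *_) xy≡0 ⟩
  (1/ x) * 0ℚ      ≡⟨ *-zeroʳ (1/ x) ⟩
  0ℚ               ∎
  where
  open ≡-Reasoning
  instance
    x-nonZero : NonZero x
    x-nonZero = ≢-nonZero x≢0

p-q≡0⇒p≡q : ∀ {p q} → p - q ≡ 0ℚ → p ≡ q
p-q≡0⇒p≡q {p} {q} p-q≡0 = begin
  p              ≡⟨ solve 2 (λ p q → p := (p :- q) :+ q) refl p q ⟩
  (p - q) + q    ≡⟨ cong (_+ q) p-q≡0 ⟩
  0ℚ + q         ≡⟨ +-identityˡ q ⟩
  q              ∎
  where open ≡-Reasoning

c*x≡x⇒x≡0 : ∀ {c x} → c ≢ 1ℚ → c * x ≡ x → x ≡ 0ℚ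
c*x≡x⇒x≡0 {c} {x} c≢1 cx≡x = *-cancelˡ-≡0 (c - 1ℚ) x (c≢1 ∘ p-q≡0⇒p≡q) (begin
  (c - 1ℚ) * x  ≡⟨ solve 2 (λ c x → (c :- con 1ℚ) :* x := c :* x :- x) refl c x ⟩
  c * x - x     ≡⟨ cong (_- x) cx≡x ⟩
  x - x         ≡⟨ +-inverseʳ x ⟩
  0ℚ            ∎)
  where open ≡-Reasoning

x*x≡0⇒x≡0 : ∀ x → x * x ≡ 0ℚ → x ≡ 0ℚ
x*x≡0⇒x≡0 x x²≡0 with x ≟ 0ℚ
... | yes x≡0 = x≡0
... | no x≢0 = *-cancelˡ-≡0 x x x≢0 x²≡0

x≡-x⇒x≡0 : ∀ x → x ≡ - x → x ≡ 0ℚ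
x≡-x⇒x≡0 x x≡-x = begin
  x              ≡⟨ solve 1 (λ x → x := con ½ :* (x :+ x)) refl x ⟩
  ½ * (x + x)    ≡⟨ cong (λ y → ½ * (x + y)) x≡-x ⟩
  ½ * (x + - x)  ≡⟨ cong (½ *_) (+-inverseʳ x) ⟩
  0ℚ             ∎
  where open ≡-Reasoning

recurrence-vanishing : ∀ (s : ℕ → ℚ) a b → (∀ m → s (5 ℕ.+ m) ≡ a * s (3 ℕ.+ m) + b * s (1 ℕ.+ m)) →
                       (∀ (j : Fin 5) → s (toℕ j) ≡ 0ℚ) → ∀ m → s m ≡ 0ℚ
recurrence-vanishing s a b rec s<5≡0 = vanish
  where
  vanish : ∀ m → s m ≡ 0ℚ
  vanish 0 = s<5≡0 zero
  vanish 1 = s<5≡0 (suc zero)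
  vanish 2 = s<5≡0 (suc (suc zero))
  vanish 3 = s<5≡0 (suc (suc (suc zero)))
  vanish 4 = s<5≡0 (suc (suc (suc (suc zero))))
  vanish (suc (suc (suc (suc (suc m))))) = begin
    s (5 ℕ.+ m)                       ≡⟨ rec m ⟩
    a * s (3 ℕ.+ m) + b * s (1 ℕ.+ m) ≡⟨ cong₂ (λ x y → a * x + b * y) (vanish (suc (suc (suc m)))) (vanish (suc m)) ⟩
    a * 0ℚ + b * 0ℚ                   ≡⟨ solve 2 (λ a b → a :* con 0ℚ :+ b :* con 0ℚ := con 0ℚ) refl a b ⟩
    0ℚ                                ∎
    where open ≡-Reasoning

sumOver-tabulate : ∀ {A : Set} {n} (g : Fin n → A) (f : A → ℚ) → sumOver (tabulate g) f ≡ ∑[ i < n ] f (g i)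
sumOver-tabulate {n = zero} g f = refl
sumOver-tabulate {n = suc n} g f = cong (f (g zero) +_) (sumOver-tabulate (g ∘ suc) f)

sumOver-++ : ∀ {A : Set} (xs ys : List A) (f : A → ℚ) → sumOver (xs ++ ys) f ≡ sumOver xs f + sumOver ys f
sumOver-++ [] ys f = sym (+-identityˡ (sumOver ys f))
sumOver-++ (x ∷ xs) ys f = trans (cong (f x +_) (sumOver-++ xs ys f)) (sym (+-assoc (f x) (sumOver xs f) (sumOver ys f)))

sumOver-map : ∀ {A B : Set} (h : A → B) (xs : List A) (f : B → ℚ) → sumOver (map h xs) f ≡ sumOver xs (f ∘ h)
sumOver-map h [] f = refl
sumOver-map h (x ∷ xs) f = cong (f (h x) +_) (sumOver-map h xs f)

sumOver-concatMap : ∀ {A B : Set} (g : A → List B) (xs : List A) (f : B → ℚ) →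
  sumOver (concatMap g xs) f ≡ sumOver xs (λ x → sumOver (g x) f)
sumOver-concatMap g [] f = refl
sumOver-concatMap g (x ∷ xs) f = trans (sumOver-++ (g x) (concatMap g xs) f) (cong (sumOver (g x) f +_) (sumOver-concatMap g xs f))

sumOver-filter : ∀ {A : Set} (p : A → Bool) (xs : List A) (f : A → ℚ) →
  sumOver (filter (λ x → p x Bool.≟ true) xs) f ≡ sumOver xs (λ x → if p x then f x else 0ℚ)
sumOver-filter p [] f = refl
sumOver-filter p (x ∷ xs) f with p x
... | true = cong (f x +_) (sumOver-filter p xs f)
... | false = trans (sumOver-filter p xs f) (sym (+-identityˡ _))

sumOver-lookup : ∀ {A : Set} (xs : List A) (f : A → ℚ) → sumOver xs f ≡ ∑[ i < length xs ] f (lookup xs i)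
sumOver-lookup [] f = refl
sumOver-lookup (x ∷ xs) f = cong (f x +_) (sumOver-lookup xs f)

sumOver-allFin : ∀ n (f : Fin n → ℚ) → sumOver (allFin n) f ≡ sum f
sumOver-allFin n f = sumOver-tabulate (λ i → i) f

-- Determinants

sign : ∀ {n} → Fin n → ℚ
sign j = if isEven (toℕ j) then 1ℚ else - 1ℚ

sign-suc : ∀ {n} (j : Fin n) → sign (suc j) ≡ - sign j
sign-suc j with isEven (toℕ j)
... | true = refl
... | false = refl

minor : ∀ {n} → Fin (suc n) → Matrix (suc n) → Matrix n
minor j A i k = A (suc i) (punchIn j k)

detℚ : ∀ {n} → Matrix n → ℚ
detℚ {zero} A = 1ℚ
detℚ {suc n} A = ∑[ j < suc n ] (sign j * A zero j * detℚ (minor j A))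

detℚ-cong : ∀ {n} {A B : Matrix n} → (∀ i j → A i j ≡ B i j) → detℚ A ≡ detℚ B
detℚ-cong {zero} A≡B = refl
detℚ-cong {suc n} A≡B = sum-cong-≗ λ j →
  cong₂ _*_ (cong (sign j *_) (A≡B zero j)) (detℚ-cong (λ i k → A≡B (suc i) (punchIn j k)))

detℚ-lift : ∀ {n} (σ : Fin n → Fin n) → (∀ (B : Matrix n) → detℚ (B ∘ σ) ≡ - detℚ B) →
            ∀ (A : Matrix (suc n)) → detℚ (A ∘ lift 1 σ) ≡ - detℚ A
detℚ-lift σ σ-odd A = trans
  (sum-cong-≗ λ j → trans (cong (sign j * A zero j *_) (σ-odd (minor j A))) (sym (neg-distribʳ-* (sign j * A zero j) _)))
  (∑-neg λ j → sign j * A zero j * detℚ (minor j A))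

-- A total `punchOut`: the position of column c among the columns other than j (junk when c = j).
punchOut′ : ∀ {m} → Fin (suc (suc m)) → Fin (suc (suc m)) → Fin (suc m)
punchOut′ zero zero = zero
punchOut′ zero (suc c) = c
punchOut′ (suc j) zero = zero
punchOut′ {zero} (suc j) (suc c) = zero
punchOut′ {suc m} (suc j) (suc c) = suc (punchOut′ j c)

punchOut′-punchIn : ∀ {m} (j : Fin (suc (suc m))) (k : Fin (suc m)) → punchOut′ j (punchIn j k) ≡ k
punchOut′-punchIn zero k = refl
punchOut′-punchIn (suc j) zero = refl
punchOut′-punchIn {suc m} (suc j) (suc k) = cong suc (punchOut′-punchIn j k)

eqᶠ-punchIn : ∀ {m} (j : Fin (suc m)) (k : Fin m) → eqᶠ (punchIn j k) j ≡ false
eqᶠ-punchIn zero k = refl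
eqᶠ-punchIn (suc j) zero = refl
eqᶠ-punchIn (suc j) (suc k) = eqᶠ-punchIn j k

punchIn-punchOut′-comm : ∀ {m} (c j : Fin (suc (suc m))) → c ≢ j → ∀ l →
  punchIn c (punchIn (punchOut′ c j) l) ≡ punchIn j (punchIn (punchOut′ j c) l)
punchIn-punchOut′-comm zero zero c≢j l = ⊥-elim (c≢j refl)
punchIn-punchOut′-comm zero (suc j) c≢j l = refl
punchIn-punchOut′-comm (suc c) zero c≢j l = refl
punchIn-punchOut′-comm {zero} (suc zero) (suc zero) c≢j l = ⊥-elim (c≢j refl)
punchIn-punchOut′-comm {suc m} (suc c) (suc j) c≢j zero = refl
punchIn-punchOut′-comm {suc m} (suc c) (suc j) c≢j (suc l) =
  cong suc (punchIn-punchOut′-comm c j (c≢j ∘ cong suc) l)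

sign-punchOut′-antisym : ∀ {m} (c j : Fin (suc (suc m))) → c ≢ j →
  sign c * sign (punchOut′ c j) ≡ - (sign j * sign (punchOut′ j c))
sign-punchOut′-antisym zero zero c≢j = ⊥-elim (c≢j refl)
sign-punchOut′-antisym zero (suc j) c≢j rewrite sign-suc j =
  solve 1 (λ s → con 1ℚ :* s := :- ((:- s) :* con 1ℚ)) refl (sign j)
sign-punchOut′-antisym (suc c) zero c≢j rewrite sign-suc c =
  solve 1 (λ s → (:- s) :* con 1ℚ := :- (con 1ℚ :* s)) refl (sign c)
sign-punchOut′-antisym {zero} (suc zero) (suc zero) c≢j = ⊥-elim (c≢j refl)
sign-punchOut′-antisym {suc m} (suc c) (suc j) c≢j
  rewrite sign-suc c | sign-suc j | sign-suc (punchOut′ c j) | sign-suc (punchOut′ j c) = begin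
    - sign c * - sign (punchOut′ c j)      ≡⟨ neg*neg (sign c) (sign (punchOut′ c j)) ⟩
    sign c * sign (punchOut′ c j)          ≡⟨ sign-punchOut′-antisym c j (c≢j ∘ cong suc) ⟩
    - (sign j * sign (punchOut′ j c))      ≡⟨ cong -_ (neg*neg (sign j) (sign (punchOut′ j c))) ⟨
    - (- sign j * - sign (punchOut′ j c))  ∎
  where
  open ≡-Reasoning
  neg*neg : ∀ a b → - a * - b ≡ a * b
  neg*neg = solve 2 (λ a b → (:- a) :* (:- b) := a :* b) refl

cofactor₂ : ∀ {m} → Matrix (suc (suc m)) → Fin (suc (suc m)) → Fin (suc (suc m)) → ℚ
cofactor₂ A j c = if eqᶠ c j then 0ℚ else
  sign j * sign (punchOut′ j c) * detℚ (λ i l → A (suc (suc i)) (punchIn j (punchIn (punchOut′ j c) l)))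

cofactor₂-antisym : ∀ {m} (A : Matrix (suc (suc m))) j c → cofactor₂ A j c ≡ - cofactor₂ A c j
cofactor₂-antisym {m} A j c with c ≟ᶠ j
... | yes refl rewrite eqᶠ-refl j = refl
... | no c≢j with j ≟ᶠ c
...   | yes j≡c = ⊥-elim (c≢j (sym j≡c))
...   | no j≢c = begin
  sign j * sign (punchOut′ j c) * detℚ (rows j c)
    ≡⟨ cong (_* detℚ (rows j c)) (sign-punchOut′-antisym j c j≢c) ⟩
  - (sign c * sign (punchOut′ c j)) * detℚ (rows j c)
    ≡⟨ cong (- (sign c * sign (punchOut′ c j)) *_) (detℚ-cong λ i l → cong (A (suc (suc i))) (punchIn-punchOut′-comm j c j≢c l)) ⟩
  - (sign c * sign (punchOut′ c j)) * detℚ (rows c j)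
    ≡⟨ neg-distribˡ-* (sign c * sign (punchOut′ c j)) (detℚ (rows c j)) ⟨
  - (sign c * sign (punchOut′ c j) * detℚ (rows c j))  ∎
  where
  open ≡-Reasoning
  rows : Fin (suc (suc m)) → Fin (suc (suc m)) → Matrix m
  rows j c i l = A (suc (suc i)) (punchIn j (punchIn (punchOut′ j c) l))

detℚ-expand₂ : ∀ {m} (A : Matrix (suc (suc m))) →
  detℚ A ≡ ∑[ j < suc (suc m) ] ∑[ c < suc (suc m) ] (A zero j * A (suc zero) c * cofactor₂ A j c)
detℚ-expand₂ {m} A = sum-cong-≗ row
  where
  open ≡-Reasoning
  row : ∀ j → sign j * A zero j * detℚ (minor j A) ≡ ∑[ c < suc (suc m) ] (A zero j * A (suc zero) c * cofactor₂ A j c)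
  row j = begin
    sign j * A zero j * detℚ (minor j A)
      ≡⟨ *-distribˡ-sum (sign j * A zero j) expansion ⟩
    ∑[ k < suc m ] (sign j * A zero j * expansion k)
      ≡⟨ sum-cong-≗ term ⟩
    ∑[ k < suc m ] f (punchIn j k)
      ≡⟨ +-identityˡ (∑[ k < suc m ] f (punchIn j k)) ⟨
    0ℚ + ∑[ k < suc m ] f (punchIn j k)
      ≡⟨ cong (_+ ∑[ k < suc m ] f (punchIn j k)) diagonal ⟨
    f j + ∑[ k < suc m ] f (punchIn j k)
      ≡⟨ sum-remove f ⟨
    sum f ∎
    where
    expansion : Fin (suc m) → ℚ
    expansion k = sign k * minor j A zero k * detℚ (minor k (minor j A))
    f : Fin (suc (suc m)) → ℚ
    f c = A zero j * A (suc zero) c * cofactor₂ A j c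
    diagonal : f j ≡ 0ℚ
    diagonal rewrite eqᶠ-refl j = *-zeroʳ (A zero j * A (suc zero) j)
    term : ∀ k → sign j * A zero j * expansion k ≡ f (punchIn j k)
    term k rewrite eqᶠ-punchIn j k | punchOut′-punchIn j k =
      solve 5 (λ a b c d e → a :* b :* (c :* d :* e) := b :* d :* (a :* c :* e)) refl
        (sign j) (A zero j) (sign k) (A (suc zero) (punchIn j k)) (detℚ (minor k (minor j A)))

detℚ-swap01 : ∀ {m} (A : Matrix (suc (suc m))) → detℚ (A ∘ transpose zero (suc zero)) ≡ - detℚ A
detℚ-swap01 {m} A = begin
  detℚ (A ∘ transpose zero (suc zero))
    ≡⟨ detℚ-expand₂ (A ∘ transpose zero (suc zero)) ⟩
  ∑[ j < suc (suc m) ] ∑[ c < suc (suc m) ] (A (suc zero) j * A zero c * cofactor₂ A j c)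
    ≡⟨ ∑-comm (λ j c → A (suc zero) j * A zero c * cofactor₂ A j c) ⟩
  ∑[ c < suc (suc m) ] ∑[ j < suc (suc m) ] (A (suc zero) j * A zero c * cofactor₂ A j c)
    ≡⟨ sum-cong-≗ (λ c → sum-cong-≗ (λ j → swapped c j)) ⟩
  ∑[ c < suc (suc m) ] ∑[ j < suc (suc m) ] (- (A zero c * A (suc zero) j * cofactor₂ A c j))
    ≡⟨ sum-cong-≗ (λ c → ∑-neg λ j → A zero c * A (suc zero) j * cofactor₂ A c j) ⟩
  ∑[ c < suc (suc m) ] (- ∑[ j < suc (suc m) ] (A zero c * A (suc zero) j * cofactor₂ A c j))
    ≡⟨ ∑-neg (λ c → ∑[ j < suc (suc m) ] (A zero c * A (suc zero) j * cofactor₂ A c j)) ⟩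
  - (∑[ c < suc (suc m) ] ∑[ j < suc (suc m) ] (A zero c * A (suc zero) j * cofactor₂ A c j))
    ≡⟨ cong -_ (detℚ-expand₂ A) ⟨
  - detℚ A ∎
  where
  open ≡-Reasoning
  swapped : ∀ c j → A (suc zero) j * A zero c * cofactor₂ A j c ≡ - (A zero c * A (suc zero) j * cofactor₂ A c j)
  swapped c j = trans (cong (A (suc zero) j * A zero c *_) (cofactor₂-antisym A j c))
    (solve 3 (λ x y z → x :* y :* (:- z) := :- (y :* x :* z)) refl (A (suc zero) j) (A zero c) (cofactor₂ A c j))

transpose₀-conjugate : ∀ {m} (b : Fin (suc m)) (i : Fin (suc (suc (suc m)))) →
  transpose zero (suc (suc b)) i ≡ lift 1 (transpose zero (suc b)) (transpose zero (suc zero) (lift 1 (transpose zero (suc b)) i))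
transpose₀-conjugate b zero = refl
transpose₀-conjugate b (suc zero) rewrite eqᶠ-refl b = refl
transpose₀-conjugate b (suc (suc i)) with i ≟ᶠ b
... | yes refl = refl
... | no i≢b rewrite dec-false (i ≟ᶠ b) i≢b = refl

-- Conjugating by the transposition (0 b+1) of the rows ≥ 1 turns (0 1) into (0 b+2).
detℚ-transpose₀-step : ∀ {m} (b : Fin (suc m)) → (∀ (B : Matrix (suc (suc m))) → detℚ (B ∘ transpose zero (suc b)) ≡ - detℚ B) →
  ∀ (A : Matrix (suc (suc (suc m)))) → detℚ (A ∘ transpose zero (suc (suc b))) ≡ - detℚ A
detℚ-transpose₀-step {m} b odd A = begin
  detℚ (A ∘ transpose zero (suc (suc b)))       ≡⟨ detℚ-cong (λ i j → cong (λ r → A r j) (transpose₀-conjugate b i)) ⟩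
  detℚ (A ∘ τ ∘ transpose zero (suc zero) ∘ τ)  ≡⟨ detℚ-lift (transpose zero (suc b)) odd (A ∘ τ ∘ transpose zero (suc zero)) ⟩
  - detℚ (A ∘ τ ∘ transpose zero (suc zero))    ≡⟨ cong -_ (detℚ-swap01 (A ∘ τ)) ⟩
  - - detℚ (A ∘ τ)                              ≡⟨ neg-involutive (detℚ (A ∘ τ)) ⟩
  detℚ (A ∘ τ)                                  ≡⟨ detℚ-lift (transpose zero (suc b)) odd A ⟩
  - detℚ A                                      ∎
  where
  open ≡-Reasoning
  τ : Fin (suc (suc (suc m))) → Fin (suc (suc (suc m)))
  τ = lift 1 (transpose zero (suc b))

detℚ-transpose₀ : ∀ {m} (b : Fin (suc m)) → b ≢ zero → ∀ (A : Matrix (suc m)) → detℚ (A ∘ transpose zero b) ≡ - detℚ A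
detℚ-transpose₀ zero b≢0 A = ⊥-elim (b≢0 refl)
detℚ-transpose₀ {suc m} (suc zero) _ A = detℚ-swap01 A
detℚ-transpose₀ {suc (suc m)} (suc (suc b)) _ A = detℚ-transpose₀-step b (detℚ-transpose₀ (suc b) λ ()) A

detℚ-equalRows : ∀ {m} (r : Fin (suc m)) → r ≢ zero → ∀ (A : Matrix (suc m)) →
  (∀ j → A r j ≡ A zero j) → detℚ A ≡ 0ℚ
detℚ-equalRows r r≢0 A Aᵣ≡A₀ = x≡-x⇒x≡0 (detℚ A)
  (trans (detℚ-cong (λ i j → sym (τA≡A i j))) (detℚ-transpose₀ r r≢0 A))
  where
  τA≡A : ∀ i j → A (transpose zero r i) j ≡ A i j
  τA≡A zero j = Aᵣ≡A₀ j
  τA≡A (suc i) j with suc i ≟ᶠ r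
  ... | yes refl = sym (Aᵣ≡A₀ j)
  ... | no _ = refl

transpositionSign : ∀ {m} → Fin (suc m) → ℚ
transpositionSign zero = 1ℚ
transpositionSign (suc _) = - 1ℚ

transpositionSign≢0 : ∀ {m} (u : Fin (suc m)) → transpositionSign u ≢ 0ℚ
transpositionSign≢0 zero ()
transpositionSign≢0 (suc _) ()

detℚ-transpose : ∀ {m} (u : Fin (suc m)) (A : Matrix (suc m)) →
  detℚ (A ∘ transpose zero u) ≡ transpositionSign u * detℚ A
detℚ-transpose zero A = trans (detℚ-cong τA≡A) (sym (*-identityˡ (detℚ A)))
  where
  τA≡A : ∀ i j → A (transpose zero zero i) j ≡ A i j
  τA≡A zero j = refl
  τA≡A (suc i) j = refl
detℚ-transpose (suc u) A = trans (detℚ-transpose₀ (suc u) (λ ()) A) (sym (-1*x≈-x (detℚ A)))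

transpose₀-self : ∀ {m} (u : Fin m) → transpose zero (suc u) (suc u) ≡ zero
transpose₀-self u rewrite eqᶠ-refl u = refl

transpose₀-fix : ∀ {m} {i : Fin m} {u : Fin (suc m)} → suc i ≢ u → transpose zero u (suc i) ≡ suc i
transpose₀-fix {i = i} {u} i≢u rewrite dec-false (suc i ≟ᶠ u) i≢u = refl

cofactor : ∀ {m} → Matrix (suc m) → Fin (suc m) → Fin (suc m) → ℚ
cofactor A u j = sign j * detℚ (minor j (A ∘ transpose zero u))

withRow₀ : ∀ {m} → (Fin (suc m) → ℚ) → Matrix (suc m) → Matrix (suc m)
withRow₀ v B zero = v
withRow₀ v B (suc r) = B (suc r)

detℚ-withRow₀ : ∀ {m} (A : Matrix (suc m)) (u i : Fin (suc m)) →
  detℚ (withRow₀ (A i) (A ∘ transpose zero u)) ≡ (if eqᶠ i u then detℚ (A ∘ transpose zero u) else 0ℚ)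
detℚ-withRow₀ A u i with i ≟ᶠ u
... | yes refl = detℚ-cong same
  where
  same : ∀ r c → withRow₀ (A i) (A ∘ transpose zero i) r c ≡ A (transpose zero i r) c
  same zero c = refl
  same (suc r) c = refl
detℚ-withRow₀ A zero zero | no i≢u = ⊥-elim (i≢u refl)
detℚ-withRow₀ A (suc u) zero | no _ =
  detℚ-equalRows (suc u) (λ ()) (withRow₀ (A zero) (A ∘ transpose zero (suc u))) (λ j → cong (λ r → A r j) (transpose₀-self u))
detℚ-withRow₀ A u (suc i) | no i≢u =
  detℚ-equalRows (suc i) (λ ()) (withRow₀ (A (suc i)) (A ∘ transpose zero u)) (λ j → cong (λ r → A r j) (transpose₀-fix i≢u))

cofactor-expansion : ∀ {m} (A : Matrix (suc m)) (u i : Fin (suc m)) →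
  ∑[ j < suc m ] (A i j * cofactor A u j) ≡ (if eqᶠ i u then transpositionSign u * detℚ A else 0ℚ)
cofactor-expansion A u i = trans
  (sum-cong-≗ λ j → reassoc (A i j) (sign j) (detℚ (minor j (A ∘ transpose zero u))))
  (trans (detℚ-withRow₀ A u i) transposed)
  where
  reassoc : ∀ a s d → a * (s * d) ≡ s * a * d
  reassoc = solve 3 (λ a s d → a :* (s :* d) := s :* a :* d) refl
  transposed : (if eqᶠ i u then detℚ (A ∘ transpose zero u) else 0ℚ)
             ≡ (if eqᶠ i u then transpositionSign u * detℚ A else 0ℚ)
  transposed with eqᶠ i u
  ... | true = detℚ-transpose u A
  ... | false = refl

-- Polynomials

eval : ℚ → Poly → ℚ
eval μ [] = 0ℚ
eval μ (a ∷ p) = a + μ * eval μ p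

eval-⊕ : ∀ μ p q → eval μ (p ⊕ q) ≡ eval μ p + eval μ q
eval-⊕ μ [] q = sym (+-identityˡ _)
eval-⊕ μ (a ∷ p) [] = sym (+-identityʳ _)
eval-⊕ μ (a ∷ p) (b ∷ q) rewrite eval-⊕ μ p q =
  solve 5 (λ a b μ x y → (a :+ b) :+ μ :* (x :+ y) := (a :+ μ :* x) :+ (b :+ μ :* y)) refl a b μ (eval μ p) (eval μ q)

eval-scale : ∀ μ c p → eval μ (scale c p) ≡ c * eval μ p
eval-scale μ c [] = sym (*-zeroʳ c)
eval-scale μ c (a ∷ p) rewrite eval-scale μ c p =
  solve 4 (λ c a μ x → c :* a :+ μ :* (c :* x) := c :* (a :+ μ :* x)) refl c a μ (eval μ p)

eval-⊗ : ∀ μ p q → eval μ (p ⊗ q) ≡ eval μ p * eval μ q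
eval-⊗ μ [] q = sym (*-zeroˡ (eval μ q))
eval-⊗ μ (a ∷ p) q rewrite eval-⊕ μ (scale a q) (0ℚ ∷ (p ⊗ q)) | eval-scale μ a q | eval-⊗ μ p q =
  solve 4 (λ a μ x y → a :* y :+ (con 0ℚ :+ μ :* (x :* y)) := (a :+ μ :* x) :* y) refl a μ (eval μ p) (eval μ q)

eval-constP : ∀ μ c → eval μ (constP c) ≡ c
eval-constP μ c = trans (cong (c +_) (*-zeroʳ μ)) (+-identityʳ c)

laplaceTerm : ∀ {m} → (Fin (suc m) → Fin (suc m) → Poly) → Fin (suc m) → Poly
laplaceTerm M j = (constP (sign j) ⊗ M zero j) ⊗ det (λ i k → M (suc i) (punchIn j k))

foldr-⊕ : ∀ {A : Set} (F : A → Poly) {g : List A → Poly} → g [] ≡ [] → (∀ x xs → g (x ∷ xs) ≡ F x ⊕ g xs) →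
  ∀ xs → g xs ≡ foldr (λ x p → F x ⊕ p) [] xs
foldr-⊕ F g[] g∷ [] = g[]
foldr-⊕ F g[] g∷ (x ∷ xs) = trans (g∷ x xs) (cong (F x ⊕_) (foldr-⊕ F g[] g∷ xs))

-- `det` folds a where-bound helper over `allFin`; abstracting the tail of that list exposes the fold.
det-laplace : ∀ {m} (M : Fin (suc m) → Fin (suc m) → Poly) → det M ≡ foldr (λ j p → laplaceTerm M j ⊕ p) [] (allFin (suc m))
det-laplace {m} M with tabulate {n = m} (λ i → suc i) | foldr-⊕ (laplaceTerm M) refl (λ _ _ → refl)
... | js | fold = cong (laplaceTerm M zero ⊕_) (fold js)

eval-foldr-⊕ : ∀ {A : Set} μ (F : A → Poly) xs → eval μ (foldr (λ x p → F x ⊕ p) [] xs) ≡ sumOver xs (eval μ ∘ F)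
eval-foldr-⊕ μ F [] = refl
eval-foldr-⊕ μ F (x ∷ xs) = trans (eval-⊕ μ (F x) _) (cong (eval μ (F x) +_) (eval-foldr-⊕ μ F xs))

eval-det : ∀ {m} μ (M : Fin m → Fin m → Poly) → eval μ (det M) ≡ detℚ (λ i j → eval μ (M i j))
eval-det {zero} μ M = eval-constP μ 1ℚ
eval-det {suc m} μ M = begin
  eval μ (det M)                                           ≡⟨ cong (eval μ) (det-laplace M) ⟩
  eval μ (foldr (λ j p → laplaceTerm M j ⊕ p) [] (allFin (suc m)))  ≡⟨ eval-foldr-⊕ μ (laplaceTerm M) (allFin (suc m)) ⟩
  sumOver (allFin (suc m)) (eval μ ∘ laplaceTerm M)         ≡⟨ sumOver-tabulate (λ j → j) (eval μ ∘ laplaceTerm M) ⟩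
  ∑[ j < suc m ] eval μ (laplaceTerm M j)                   ≡⟨ sum-cong-≗ term ⟩
  detℚ (λ i j → eval μ (M i j))                             ∎
  where
  open ≡-Reasoning
  term : ∀ j → eval μ (laplaceTerm M j) ≡ sign j * eval μ (M zero j) * detℚ (minor j (λ i j → eval μ (M i j)))
  term j = trans (eval-⊗ μ (constP (sign j) ⊗ M zero j) _)
    (cong₂ _*_ (trans (eval-⊗ μ (constP (sign j)) (M zero j)) (cong (_* eval μ (M zero j)) (eval-constP μ (sign j))))
               (eval-det μ (λ i k → M (suc i) (punchIn j k))))

divideLinear : ℚ → Poly → Poly
divideLinear c [] = []
divideLinear c (a ∷ []) = []
divideLinear c (a ∷ b ∷ r) = eval c (b ∷ r) ∷ divideLinear c (b ∷ r)

eval-divideLinear : ∀ μ c r → eval μ r ≡ (μ - c) * eval μ (divideLinear c r) + eval c r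
eval-divideLinear μ c [] = solve 2 (λ μ c → con 0ℚ := (μ :- c) :* con 0ℚ :+ con 0ℚ) refl μ c
eval-divideLinear μ c (a ∷ []) = solve 3 (λ a μ c → a :+ μ :* con 0ℚ := (μ :- c) :* con 0ℚ :+ (a :+ c :* con 0ℚ)) refl a μ c
eval-divideLinear μ c (a ∷ b ∷ r) rewrite eval-divideLinear μ c (b ∷ r) =
  solve 5 (λ a μ c q e → a :+ μ :* ((μ :- c) :* q :+ e) := (μ :- c) :* (e :+ μ :* q) :+ (a :+ c :* e))
    refl a μ c (eval μ (divideLinear c (b ∷ r))) (eval c (b ∷ r))

coeff-divideLinear-zero : ∀ c r → coeff r 0 ≡ eval c r - c * coeff (divideLinear c r) 0
coeff-divideLinear-zero c [] = solve 1 (λ c → con 0ℚ := con 0ℚ :- c :* con 0ℚ) refl c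
coeff-divideLinear-zero c (a ∷ []) = solve 2 (λ a c → a := a :+ c :* con 0ℚ :- c :* con 0ℚ) refl a c
coeff-divideLinear-zero c (a ∷ b ∷ r) = solve 3 (λ a c e → a := a :+ c :* e :- c :* e) refl a c (eval c (b ∷ r))

coeff-divideLinear-suc : ∀ c r i → coeff r (suc i) ≡ coeff (divideLinear c r) i - c * coeff (divideLinear c r) (suc i)
coeff-divideLinear-suc c [] i = solve 1 (λ c → con 0ℚ := con 0ℚ :- c :* con 0ℚ) refl c
coeff-divideLinear-suc c (a ∷ []) zero = solve 1 (λ c → con 0ℚ := con 0ℚ :- c :* con 0ℚ) refl c
coeff-divideLinear-suc c (a ∷ []) (suc i) = solve 1 (λ c → con 0ℚ := con 0ℚ :- c :* con 0ℚ) refl c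
coeff-divideLinear-suc c (a ∷ b ∷ r) zero = coeff-divideLinear-zero c (b ∷ r)
coeff-divideLinear-suc c (a ∷ b ∷ r) (suc i) = coeff-divideLinear-suc c (b ∷ r) i

length-divideLinear : ∀ c r {L} → length r ℕ.≤ suc L → length (divideLinear c r) ℕ.≤ L
length-divideLinear c [] _ = z≤n
length-divideLinear c (a ∷ []) _ = z≤n
length-divideLinear c (a ∷ b ∷ r) {suc L} (s≤s r≤L) = s≤s (length-divideLinear c (b ∷ r) r≤L)

-- Divide off the root c + 1: the quotient has lower degree and still vanishes beyond c + 1.
coeff-vanishing : ∀ L r → length r ℕ.≤ L → ∀ c → (∀ μ → c < μ → eval μ r ≡ 0ℚ) → ∀ i → coeff r i ≡ 0ℚ
coeff-vanishing zero [] _ _ _ _ = refl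
coeff-vanishing (suc L) r r≤L c r≡0 = coeffs
  where
  c′ : ℚ
  c′ = c + 1ℚ
  c<c′ : c < c′
  c<c′ = subst (_< c′) (+-identityʳ c) (+-monoʳ-< c (from-yes (0ℚ <? 1ℚ)))
  r[c′]≡0 : eval c′ r ≡ 0ℚ
  r[c′]≡0 = r≡0 c′ c<c′
  q : Poly
  q = divideLinear c′ r
  q≡0 : ∀ μ → c′ < μ → eval μ q ≡ 0ℚ
  q≡0 μ c′<μ = *-cancelˡ-≡0 (μ - c′) (eval μ q) μ-c′≢0 (begin
    (μ - c′) * eval μ q               ≡⟨ +-identityʳ ((μ - c′) * eval μ q) ⟨
    (μ - c′) * eval μ q + 0ℚ          ≡⟨ cong ((μ - c′) * eval μ q +_) r[c′]≡0 ⟨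
    (μ - c′) * eval μ q + eval c′ r   ≡⟨ eval-divideLinear μ c′ r ⟨
    eval μ r                          ≡⟨ r≡0 μ (<-trans c<c′ c′<μ) ⟩
    0ℚ                                ∎)
    where
    open ≡-Reasoning
    μ-c′≢0 : μ - c′ ≢ 0ℚ
    μ-c′≢0 μ-c′≡0 = <⇒≢ c′<μ (sym (p-q≡0⇒p≡q μ-c′≡0))
  qᵢ≡0 : ∀ i → coeff q i ≡ 0ℚ
  qᵢ≡0 = coeff-vanishing L q (length-divideLinear c′ r r≤L) c′ q≡0
  a-c′b≡0 : ∀ {a b} → a ≡ 0ℚ → b ≡ 0ℚ → a - c′ * b ≡ 0ℚ
  a-c′b≡0 refl refl = solve 1 (λ c → con 0ℚ :- c :* con 0ℚ := con 0ℚ) refl c′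
  coeffs : ∀ i → coeff r i ≡ 0ℚ
  coeffs zero = trans (coeff-divideLinear-zero c′ r) (a-c′b≡0 r[c′]≡0 (qᵢ≡0 0))
  coeffs (suc i) = trans (coeff-divideLinear-suc c′ r i) (a-c′b≡0 (qᵢ≡0 i) (qᵢ≡0 (suc i)))

coeff-⊕ : ∀ p q i → coeff (p ⊕ q) i ≡ coeff p i + coeff q i
coeff-⊕ [] q i = sym (+-identityˡ _)
coeff-⊕ (a ∷ p) [] i = sym (+-identityʳ _)
coeff-⊕ (a ∷ p) (b ∷ q) zero = refl
coeff-⊕ (a ∷ p) (b ∷ q) (suc i) = coeff-⊕ p q i

coeff-scale : ∀ c p i → coeff (scale c p) i ≡ c * coeff p i
coeff-scale c [] i = sym (*-zeroʳ c)
coeff-scale c (a ∷ p) zero = refl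
coeff-scale c (a ∷ p) (suc i) = coeff-scale c p i

eval-injective : ∀ p q → (∀ μ → eval μ p ≡ eval μ q) → p ≈P q
eval-injective p q p≡q i = begin
  coeff p i                                  ≡⟨ solve 2 (λ x y → x := (x :+ con (- 1ℚ) :* y) :+ y) refl (coeff p i) (coeff q i) ⟩
  coeff p i + (- 1ℚ) * coeff q i + coeff q i ≡⟨ cong (_+ coeff q i) (trans (sym (coeff-difference i)) (p-q≡0 i)) ⟩
  0ℚ + coeff q i                             ≡⟨ +-identityˡ (coeff q i) ⟩
  coeff q i                                  ∎
  where
  open ≡-Reasoning
  coeff-difference : ∀ i → coeff (p ⊕ negP q) i ≡ coeff p i + (- 1ℚ) * coeff q i
  coeff-difference i = trans (coeff-⊕ p (negP q) i) (cong (coeff p i +_) (coeff-scale (- 1ℚ) q i))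
  difference : ∀ μ → eval μ (p ⊕ negP q) ≡ 0ℚ
  difference μ = begin
    eval μ (p ⊕ negP q)             ≡⟨ eval-⊕ μ p (negP q) ⟩
    eval μ p + eval μ (negP q)      ≡⟨ cong₂ _+_ (p≡q μ) (eval-scale μ (- 1ℚ) q) ⟩
    eval μ q + (- 1ℚ) * eval μ q    ≡⟨ solve 1 (λ x → x :+ con (- 1ℚ) :* x := con 0ℚ) refl (eval μ q) ⟩
    0ℚ                              ∎
  p-q≡0 : ∀ i → coeff (p ⊕ negP q) i ≡ 0ℚ
  p-q≡0 = coeff-vanishing _ (p ⊕ negP q) ℕₚ.≤-refl 0ℚ (λ μ _ → difference μ)

polySum : ∀ k → (Fin k → Poly) → Poly
polySum zero f = []
polySum (suc k) f = f zero ⊕ polySum k (f ∘ suc)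

eval-polySum : ∀ μ k f → eval μ (polySum k f) ≡ ∑[ i < k ] eval μ (f i)
eval-polySum μ zero f = refl
eval-polySum μ (suc k) f = trans (eval-⊕ μ (f zero) (polySum k (f ∘ suc))) (cong (eval μ (f zero) +_) (eval-polySum μ k (f ∘ suc)))

-- Polynomials of a matrix and the Cayley–Hamilton theorem

module Action {n : ℕ} (T : Matrix n) where

  ℚⁿ : Set
  ℚⁿ = Fin n → ℚ

  0ᵥ : ℚⁿ
  0ᵥ _ = 0ℚ

  infixl 6 _+ᵥ_
  infixr 7 _·ᵥ_

  _+ᵥ_ : ℚⁿ → ℚⁿ → ℚⁿ
  (w +ᵥ w′) v = w v + w′ v

  _·ᵥ_ : ℚ → ℚⁿ → ℚⁿ
  (c ·ᵥ w) v = c * w v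

  basis : Fin n → ℚⁿ
  basis u v = δ v u

  apply : ℚⁿ → ℚⁿ
  apply w v = ∑[ j < n ] (T v j * w j)

  apply-cong : ∀ {w w′} → w ≗ w′ → apply w ≗ apply w′
  apply-cong w≗w′ v = sum-cong-≗ λ j → cong (T v j *_) (w≗w′ j)

  apply-+ : ∀ w w′ → apply (w +ᵥ w′) ≗ apply w +ᵥ apply w′
  apply-+ w w′ v =
    trans (sum-cong-≗ λ j → *-distribˡ-+ (T v j) (w j) (w′ j)) (∑-distrib-+ (λ j → T v j * w j) (λ j → T v j * w′ j))

  apply-· : ∀ c w → apply (c ·ᵥ w) ≗ c ·ᵥ apply w
  apply-· c w v = trans (sum-cong-≗ λ j → *-left-commute (T v j) c (w j)) (∑-*ˡ c λ j → T v j * w j)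
    where
    *-left-commute : ∀ t c x → t * (c * x) ≡ c * (t * x)
    *-left-commute = solve 3 (λ t c x → t :* (c :* x) := c :* (t :* x)) refl

  apply-0 : apply 0ᵥ ≗ 0ᵥ
  apply-0 v = trans (sum-cong-≗ λ j → *-zeroʳ (T v j)) (∑-zero n)

  act : Poly → ℚⁿ → ℚⁿ
  act [] w v = 0ℚ
  act (a ∷ p) w v = a * w v + apply (act p w) v

  act-cong : ∀ p {w w′} → w ≗ w′ → act p w ≗ act p w′
  act-cong [] w≗w′ v = refl
  act-cong (a ∷ p) w≗w′ v = cong₂ _+_ (cong (a *_) (w≗w′ v)) (apply-cong (act-cong p w≗w′) v)

  act-+ : ∀ p w w′ → act p (w +ᵥ w′) ≗ act p w +ᵥ act p w′
  act-+ [] w w′ v = sym (+-identityʳ 0ℚ)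
  act-+ (a ∷ p) w w′ v = trans (cong (a * (w v + w′ v) +_) (trans (apply-cong (act-+ p w w′) v) (apply-+ (act p w) (act p w′) v)))
    (solve 5 (λ a x y X Y → a :* (x :+ y) :+ (X :+ Y) := (a :* x :+ X) :+ (a :* y :+ Y)) refl
      a (w v) (w′ v) (apply (act p w) v) (apply (act p w′) v))

  act-· : ∀ p c w → act p (c ·ᵥ w) ≗ c ·ᵥ act p w
  act-· [] c w v = sym (*-zeroʳ c)
  act-· (a ∷ p) c w v = trans (cong (a * (c * w v) +_) (trans (apply-cong (act-· p c w) v) (apply-· c (act p w) v)))
    (solve 4 (λ a c x X → a :* (c :* x) :+ c :* X := c :* (a :* x :+ X)) refl a c (w v) (apply (act p w) v))

  act-0 : ∀ p → act p 0ᵥ ≗ 0ᵥ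
  act-0 [] v = refl
  act-0 (a ∷ p) v = trans (cong₂ _+_ (*-zeroʳ a) (trans (apply-cong (act-0 p) v) (apply-0 v))) (+-identityʳ 0ℚ)

  act-∑ : ∀ p {k} (W : Fin k → ℚⁿ) → act p (λ v → ∑[ i < k ] W i v) ≗ (λ v → ∑[ i < k ] act p (W i) v)
  act-∑ p {zero} W v = act-0 p v
  act-∑ p {suc k} W v = trans (act-+ p (W zero) (λ v′ → ∑[ i < k ] W (suc i) v′) v) (cong (act p (W zero) v +_) (act-∑ p (W ∘ suc) v))

  act-apply : ∀ p w → act p (apply w) ≗ apply (act p w)
  act-apply [] w v = sym (apply-0 v)
  act-apply (a ∷ p) w v = trans (cong (a * apply w v +_) (apply-cong (act-apply p w) v))
    (sym (trans (apply-+ (a ·ᵥ w) (apply (act p w)) v) (cong (_+ apply (apply (act p w)) v) (apply-· a w v))))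

  act-⊕ : ∀ p q w → act (p ⊕ q) w ≗ act p w +ᵥ act q w
  act-⊕ [] q w v = sym (+-identityˡ _)
  act-⊕ (a ∷ p) [] w v = sym (+-identityʳ _)
  act-⊕ (a ∷ p) (b ∷ q) w v = trans (cong ((a + b) * w v +_) (trans (apply-cong (act-⊕ p q w) v) (apply-+ (act p w) (act q w) v)))
    (solve 5 (λ a b x X Y → (a :+ b) :* x :+ (X :+ Y) := (a :* x :+ X) :+ (b :* x :+ Y)) refl a b (w v) (apply (act p w) v) (apply (act q w) v))

  act-scale : ∀ c p w → act (scale c p) w ≗ c ·ᵥ act p w
  act-scale c [] w v = sym (*-zeroʳ c)
  act-scale c (a ∷ p) w v = trans (cong (c * a * w v +_) (trans (apply-cong (act-scale c p w) v) (apply-· c (act p w) v)))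
    (solve 4 (λ c a x X → c :* a :* x :+ c :* X := c :* (a :* x :+ X)) refl c a (w v) (apply (act p w) v))

  act-⊗ : ∀ p q w → act (p ⊗ q) w ≗ act p (act q w)
  act-⊗ [] q w v = refl
  act-⊗ (a ∷ p) q w v = trans (act-⊕ (scale a q) (0ℚ ∷ (p ⊗ q)) w v)
    (cong₂ _+_ (act-scale a q w v)
      (trans (cong₂ _+_ (*-zeroˡ (w v)) (apply-cong (act-⊗ p q w) v)) (+-identityˡ _)))

  act-comm : ∀ p q w → act p (act q w) ≗ act q (act p w)
  act-comm p [] w v = act-0 p v
  act-comm p (b ∷ q) w v = trans (act-+ p (b ·ᵥ w) (apply (act q w)) v)
    (cong₂ _+_ (act-· p b w v) (trans (act-apply p (act q w) v) (apply-cong (act-comm p q w) v)))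

  act-constP : ∀ c w → act (constP c) w ≗ c ·ᵥ w
  act-constP c w v = trans (cong (c * w v +_) (apply-0 v)) (+-identityʳ _)

  act-X : ∀ w → act X w ≗ apply w
  act-X w v = trans (cong₂ _+_ (*-zeroˡ (w v)) (apply-cong 1w≗w v)) (+-identityˡ (apply w v))
    where
    1w≗w : act (constP 1ℚ) w ≗ w
    1w≗w v′ = trans (act-constP 1ℚ w v′) (*-identityˡ (w v′))

  apply-eigen : ∀ μ c {z w} → apply z ≗ μ ·ᵥ z → w ≗ c ·ᵥ z → apply w ≗ c ·ᵥ μ ·ᵥ z
  apply-eigen μ c {z} Tz≗μz w≗cz v = trans (apply-cong w≗cz v) (trans (apply-· c z v) (cong (c *_) (Tz≗μz v)))

  act-eigen : ∀ {μ z} → apply z ≗ μ ·ᵥ z → ∀ p → act p z ≗ eval μ p ·ᵥ z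
  act-eigen {μ} {z} Tz≗μz [] v = sym (*-zeroˡ (z v))
  act-eigen {μ} {z} Tz≗μz (a ∷ p) v = trans (cong (a * z v +_) (apply-eigen μ (eval μ p) Tz≗μz (act-eigen Tz≗μz p) v))
    (solve 4 (λ a c μ x → a :* x :+ c :* (μ :* x) := (a :+ μ :* c) :* x) refl a (eval μ p) μ (z v))

  apply^ : ℕ → ℚⁿ → ℚⁿ
  apply^ zero w = w
  apply^ (suc m) w = apply (apply^ m w)

  powerSum : Poly → ℕ → ℚⁿ → ℚⁿ
  powerSum [] j w v = 0ℚ
  powerSum (a ∷ p) j w v = a * apply^ j w v + powerSum p (suc j) w v

  apply-powerSum : ∀ p j w → apply (powerSum p j w) ≗ powerSum p (suc j) w
  apply-powerSum [] j w = apply-0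
  apply-powerSum (a ∷ p) j w v = trans (apply-+ (a ·ᵥ apply^ j w) (powerSum p (suc j) w) v)
    (cong₂ _+_ (apply-· a (apply^ j w) v) (apply-powerSum p (suc j) w v))

  act-apply^ : ∀ p j w → act p (apply^ j w) ≗ powerSum p j w
  act-apply^ [] j w v = refl
  act-apply^ (a ∷ p) j w v = cong (a * apply^ j w v +_) (trans (apply-cong (act-apply^ p j w) v) (apply-powerSum p j w v))

  act-apply^-annihilated : ∀ p {w} → act p w ≗ 0ᵥ → ∀ m → act p (apply^ m w) ≗ 0ᵥ
  act-apply^-annihilated p pw≗0 zero = pw≗0
  act-apply^-annihilated p {w} pw≗0 (suc m) v =
    trans (act-apply p (apply^ m w) v) (trans (apply-cong (act-apply^-annihilated p pw≗0 m) v) (apply-0 v))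

  act-polySum : ∀ k f w → act (polySum k f) w ≗ (λ v → ∑[ i < k ] act (f i) w v)
  act-polySum zero f w v = refl
  act-polySum (suc k) f w v = trans (act-⊕ (f zero) (polySum k (f ∘ suc)) w v) (cong (act (f zero) w v +_) (act-polySum k (f ∘ suc) w v))

  act-≈[] : ∀ p → p ≈P [] → ∀ w → act p w ≗ 0ᵥ
  act-≈[] [] p≈0 w v = refl
  act-≈[] (a ∷ p) p≈0 w v = trans
    (cong₂ _+_ (trans (cong (_* w v) (p≈0 0)) (*-zeroˡ (w v))) (trans (apply-cong (act-≈[] p (p≈0 ∘ suc) w) v) (apply-0 v)))
    (+-identityʳ 0ℚ)

  act-≈P : ∀ p q → p ≈P q → ∀ w → act p w ≗ act q w
  act-≈P [] q p≈q w v = sym (act-≈[] q (sym ∘ p≈q) w v)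
  act-≈P (a ∷ p) [] p≈q w v = act-≈[] (a ∷ p) p≈q w v
  act-≈P (a ∷ p) (b ∷ q) p≈q w v = cong₂ _+_ (cong (_* w v) (p≈q 0)) (apply-cong (act-≈P p q (p≈q ∘ suc) w) v)

charMatrix : ∀ {n} → Matrix n → Fin n → Fin n → Poly
charMatrix T i j = (if eqᶠ i j then X else []) ⊕ constP (- T i j)

cofactorPoly : ∀ {m} → Matrix (suc m) → Fin (suc m) → Fin (suc m) → Poly
cofactorPoly T u j = constP (sign j) ⊗ det (λ i k → charMatrix T (transpose zero u (suc i)) (punchIn j k))

signedCharPoly : ∀ {m} → Matrix (suc m) → Fin (suc m) → Poly
signedCharPoly T u = constP (transpositionSign u) ⊗ charPoly T

adjugateProduct : ∀ {m} → Matrix (suc m) → Fin (suc m) → Fin (suc m) → Poly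
adjugateProduct {m} T u i = polySum (suc m) (λ j → charMatrix T i j ⊗ cofactorPoly T u j)

adjugate-identity : ∀ {m} (T : Matrix (suc m)) (u i : Fin (suc m)) →
  adjugateProduct T u i ≈P (if eqᶠ i u then signedCharPoly T u else [])
adjugate-identity {m} T u i = eval-injective (adjugateProduct T u i) (if eqᶠ i u then signedCharPoly T u else []) λ μ → begin
  eval μ (adjugateProduct T u i)
    ≡⟨ eval-polySum μ (suc m) (λ j → charMatrix T i j ⊗ cofactorPoly T u j) ⟩
  ∑[ j < suc m ] eval μ (charMatrix T i j ⊗ cofactorPoly T u j)
    ≡⟨ sum-cong-≗ (entry μ) ⟩
  ∑[ j < suc m ] (A μ i j * cofactor (A μ) u j)
    ≡⟨ cofactor-expansion (A μ) u i ⟩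
  (if eqᶠ i u then transpositionSign u * detℚ (A μ) else 0ℚ)
    ≡⟨ diagonal μ ⟩
  eval μ (if eqᶠ i u then signedCharPoly T u else [])  ∎
  where
  open ≡-Reasoning
  A : ℚ → Matrix (suc m)
  A μ a b = eval μ (charMatrix T a b)
  entry : ∀ μ j → eval μ (charMatrix T i j ⊗ cofactorPoly T u j) ≡ A μ i j * cofactor (A μ) u j
  entry μ j = trans (eval-⊗ μ (charMatrix T i j) (cofactorPoly T u j)) (cong (A μ i j *_)
    (trans (eval-⊗ μ (constP (sign j)) (det minorⱼ)) (cong₂ _*_ (eval-constP μ (sign j)) (eval-det μ minorⱼ))))
    where
    minorⱼ : Fin m → Fin m → Poly
    minorⱼ a k = charMatrix T (transpose zero u (suc a)) (punchIn j k)
  diagonal : ∀ μ → (if eqᶠ i u then transpositionSign u * detℚ (A μ) else 0ℚ)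
                 ≡ eval μ (if eqᶠ i u then signedCharPoly T u else [])
  diagonal μ with eqᶠ i u
  ... | true = sym (trans (eval-⊗ μ (constP (transpositionSign u)) (charPoly T))
                   (cong₂ _*_ (eval-constP μ (transpositionSign u)) (eval-det μ (charMatrix T))))
  ... | false = refl

-- Apply row i of the adjugate identity, evaluated at T, to eᵢ and sum over i: column j of the
-- left side is adj(T)ⱼ applied to ∑ᵢ (δᵢⱼ T − Tᵢⱼ) eᵢ = 0.
cayley-hamilton : ∀ {n} (T : Matrix n) u → Action.act T (charPoly T) (Action.basis T u) ≗ Action.0ᵥ T
cayley-hamilton {suc m} T u v = *-cancelˡ-≡0 (transpositionSign u) _ (transpositionSign≢0 u) (begin
  transpositionSign u * act (charPoly T) (basis u) v
    ≡⟨ trans (act-⊗ (constP (transpositionSign u)) (charPoly T) (basis u) v)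
             (act-constP (transpositionSign u) (act (charPoly T) (basis u)) v) ⟨
  act (signedCharPoly T u) (basis u) v
    ≡⟨ ∑-if u (λ i → act (signedCharPoly T u) (basis i) v) ⟨
  ∑[ i < suc m ] (if eqᶠ i u then act (signedCharPoly T u) (basis i) v else 0ℚ)
    ≡⟨ sum-cong-≗ act-scalar ⟨
  ∑[ i < suc m ] act (scalar i) (basis i) v
    ≡⟨ sum-cong-≗ (λ i → act-≈P (adjugateProduct T u i) (scalar i) (adjugate-identity T u i) (basis i) v) ⟨
  ∑[ i < suc m ] act (adjugateProduct T u i) (basis i) v
    ≡⟨ sum-cong-≗ (λ i → trans (act-polySum (suc m) (λ j → M i j ⊗ C j) (basis i) v) (sum-cong-≗ (factor i))) ⟩
  ∑[ i < suc m ] ∑[ j < suc m ] act (C j) (act (M i j) (basis i)) v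
    ≡⟨ ∑-comm (λ i j → act (C j) (act (M i j) (basis i)) v) ⟩
  ∑[ j < suc m ] ∑[ i < suc m ] act (C j) (act (M i j) (basis i)) v
    ≡⟨ sum-cong-≗ (λ j → act-∑ (C j) (λ i → act (M i j) (basis i)) v) ⟨
  ∑[ j < suc m ] act (C j) (λ v′ → ∑[ i < suc m ] act (M i j) (basis i) v′) v
    ≡⟨ sum-cong-≗ (λ j → trans (act-cong (C j) (column j) v) (act-0 (C j) v)) ⟩
  ∑[ j < suc m ] 0ℚ
    ≡⟨ ∑-zero (suc m) ⟩
  0ℚ ∎)
  where
  open ≡-Reasoning
  open Action T
  M : Fin (suc m) → Fin (suc m) → Poly
  M = charMatrix T
  C : Fin (suc m) → Poly
  C = cofactorPoly T u
  scalar : Fin (suc m) → Poly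
  scalar i = if eqᶠ i u then signedCharPoly T u else []
  act-scalar : ∀ i → act (scalar i) (basis i) v ≡ (if eqᶠ i u then act (signedCharPoly T u) (basis i) v else 0ℚ)
  act-scalar i with eqᶠ i u
  ... | true = refl
  ... | false = refl
  factor : ∀ i j → act (M i j ⊗ C j) (basis i) v ≡ act (C j) (act (M i j) (basis i)) v
  factor i j = trans (act-⊗ (M i j) (C j) (basis i) v) (act-comm (M i j) (C j) (basis i) v)
  column : ∀ j v′ → ∑[ i < suc m ] act (M i j) (basis i) v′ ≡ 0ℚ
  column j v′ = begin
    ∑[ i < suc m ] act (M i j) (basis i) v′
      ≡⟨ sum-cong-≗ (λ i → act-⊕ (Xᵢ i) (constP (- T i j)) (basis i) v′) ⟩
    ∑[ i < suc m ] (act (Xᵢ i) (basis i) v′ + act (constP (- T i j)) (basis i) v′)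
      ≡⟨ ∑-distrib-+ (λ i → act (Xᵢ i) (basis i) v′) (λ i → act (constP (- T i j)) (basis i) v′) ⟩
    ∑[ i < suc m ] act (Xᵢ i) (basis i) v′ + ∑[ i < suc m ] act (constP (- T i j)) (basis i) v′
      ≡⟨ cong₂ _+_ (trans (sum-cong-≗ diagonal) (∑-if j (λ i → apply (basis i) v′)))
                   (sum-cong-≗ λ i → act-constP (- T i j) (basis i) v′) ⟩
    apply (basis j) v′ + ∑[ i < suc m ] (- T i j * δ v′ i)
      ≡⟨ cong₂ _+_ (trans (sum-cong-≗ λ l → *-comm (T v′ l) (δ l j)) (∑-δʳ j (T v′)))
                   (trans (sum-cong-≗ λ i → *-comm (- T i j) (δ v′ i)) (∑-δˡ v′ (λ i → - T i j))) ⟩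
    T v′ j + - T v′ j
      ≡⟨ +-inverseʳ (T v′ j) ⟩
    0ℚ ∎
    where
    Xᵢ : Fin (suc m) → Poly
    Xᵢ i = if eqᶠ i j then X else []
    diagonal : ∀ i → act (Xᵢ i) (basis i) v′ ≡ (if eqᶠ i j then apply (basis i) v′ else 0ℚ)
    diagonal i with eqᶠ i j
    ... | true = act-X (basis i) v′
    ... | false = refl

-- Lucas sequences and Niven's theorem

2ℚ 4ℚ : ℚ
2ℚ = 1ℚ + 1ℚ
4ℚ = 2ℚ + 2ℚ

-- V_k(y) for the Lucas sequence with P = y and Q = 1, so that V_k(2 cos θ) = 2 cos kθ.
lucasV : ℚ → ℕ → ℚ
lucasV y zero = 2ℚ
lucasV y (suc zero) = y
lucasV y (suc (suc k)) = y * lucasV y (suc k) - lucasV y k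

lucasV-increasing : ∀ {y} → 2ℚ < y → ∀ k → 2ℚ ≤ lucasV y k × lucasV y k < lucasV y (suc k)
lucasV-increasing 2<y zero = ≤-refl , 2<y
lucasV-increasing {y} 2<y (suc k) with lucasV-increasing 2<y k
... | 2≤a , a<b = 2≤b , b<c
  where
  a b : ℚ
  a = lucasV y k
  b = lucasV y (suc k)
  2≤b : 2ℚ ≤ b
  2≤b = <⇒≤ (≤-<-trans 2≤a a<b)
  0<c-b : 0ℚ < (y * b - a) - b
  0<c-b = subst (0ℚ <_) (solve 3 (λ y a b → (y :- con 2ℚ) :* b :+ (b :- a) := (y :* b :- a) :- b) refl y a b)
    (+-mono-< (0<p*q (p<q⇒0<q-p 2<y) (<-≤-trans (from-yes (0ℚ <? 2ℚ)) 2≤b)) (p<q⇒0<q-p a<b))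
  b<c : b < y * b - a
  b<c = 0<q-p⇒p<q 0<c-b

2<lucasV : ∀ {y} → 2ℚ < y → ∀ k → 2ℚ < lucasV y (suc k)
2<lucasV 2<y k = let 2≤a , a<b = lucasV-increasing 2<y k in ≤-<-trans 2≤a a<b

altSign : ℕ → ℚ
altSign zero = 1ℚ
altSign (suc k) = - altSign k

altSign-cases : ∀ k → altSign k ≡ 1ℚ ⊎ altSign k ≡ - 1ℚ
altSign-cases zero = inj₁ refl
altSign-cases (suc k) with altSign-cases k
... | inj₁ s≡1 = inj₂ (cong -_ s≡1)
... | inj₂ s≡-1 = inj₁ (cong -_ s≡-1)

lucasV-neg : ∀ y k → lucasV y k ≡ altSign k * lucasV (- y) k
lucasV-neg y zero = sym (*-identityˡ 2ℚ)
lucasV-neg y (suc zero) = solve 1 (λ y → y := :- con 1ℚ :* (:- y)) refl y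
lucasV-neg y (suc (suc k)) = trans (cong₂ (λ b a → y * b - a) (lucasV-neg y (suc k)) (lucasV-neg y k))
  (solve 4 (λ y s a b → y :* ((:- s) :* b) :- s :* a := (:- (:- s)) :* ((:- y) :* b :- a)) refl
    y (altSign k) (lucasV (- y) k) (lucasV (- y) (suc k)))

lucasV≢2-large : ∀ {y} → 2ℚ < y → ∀ k → lucasV y (suc k) ≢ 2ℚ
lucasV≢2-large 2<y k V≡2 = <-irrefl (sym V≡2) (2<lucasV 2<y k)

lucasV≢2-small : ∀ {y} → y < - 2ℚ → ∀ k → lucasV y (suc k) ≢ 2ℚ
lucasV≢2-small {y} y<-2 k V≡2 with altSign-cases (suc k)
... | inj₁ s≡1 = <-irrefl (sym W≡2) (2<lucasV (neg-antimono-< y<-2) k)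
  where
  W≡2 : lucasV (- y) (suc k) ≡ 2ℚ
  W≡2 = begin
    lucasV (- y) (suc k)                         ≡⟨ *-identityˡ _ ⟨
    1ℚ * lucasV (- y) (suc k)                    ≡⟨ cong (_* lucasV (- y) (suc k)) s≡1 ⟨
    altSign (suc k) * lucasV (- y) (suc k)       ≡⟨ lucasV-neg y (suc k) ⟨
    lucasV y (suc k)                             ≡⟨ V≡2 ⟩
    2ℚ                                           ∎
    where open ≡-Reasoning
... | inj₂ s≡-1 = <-asym (2<lucasV (neg-antimono-< y<-2) k) (subst (_< 2ℚ) (sym W≡-2) (from-yes (- 2ℚ <? 2ℚ)))
  where
  W≡-2 : lucasV (- y) (suc k) ≡ - 2ℚ
  W≡-2 = begin
    lucasV (- y) (suc k)                         ≡⟨ solve 1 (λ x → x := :- (:- con 1ℚ :* x)) refl _ ⟩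
    - (- 1ℚ * lucasV (- y) (suc k))              ≡⟨ cong (λ s → - (s * lucasV (- y) (suc k))) s≡-1 ⟨
    - (altSign (suc k) * lucasV (- y) (suc k))   ≡⟨ cong -_ (lucasV-neg y (suc k)) ⟨
    - lucasV y (suc k)                           ≡⟨ cong -_ V≡2 ⟩
    - 2ℚ                                         ∎
    where open ≡-Reasoning

fromℤ : ℤ → ℚ
fromℤ z = mkℚ z 0 (coprime-sym (1-coprimeTo _))

fromℤ-* : ∀ a b → fromℤ a * fromℤ b ≡ fromℤ (a ℤ.* b)
fromℤ-* a b = ↥p/↧p≡p (fromℤ (a ℤ.* b))

fromℤ-+ : ∀ a b → fromℤ a + fromℤ b ≡ fromℤ (a ℤ.+ b)
fromℤ-+ a b = trans (cong (_/ 1) (unit a b)) (↥p/↧p≡p (fromℤ (a ℤ.+ b)))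
  where
  unit : ∀ a b → a ℤ.* ℤ.+ 1 ℤ.+ b ℤ.* ℤ.+ 1 ≡ a ℤ.+ b
  unit = solve-∀

fromℤ-sub : ∀ a b → fromℤ a - fromℤ b ≡ fromℤ (a ℤ.- b)
fromℤ-sub a b = trans (cong (λ x → fromℤ a + x) (fromℤ-neg b)) (fromℤ-+ a (ℤ.- b))
  where
  fromℤ-neg : ∀ a → - fromℤ a ≡ fromℤ (ℤ.- a)
  fromℤ-neg (ℤ.+ zero) = refl
  fromℤ-neg (ℤ.+ suc n) = refl
  fromℤ-neg ℤ.-[1+ n ] = refl

mkℚ*denominator : ∀ p d .(c : Coprime ℤ.∣ p ∣ (suc d)) → mkℚ p d c * fromℤ (ℤ.+ suc d) ≡ fromℤ p
mkℚ*denominator p d c = toℚᵘ-injective (ℚᵘₚ.≃-trans (toℚᵘ-homo-* (mkℚ p d c) (fromℤ (ℤ.+ suc d))) (ℚᵘ.*≡* cross))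
  where
  cross : (p ℤ.* ℤ.+ suc d) ℤ.* ℤ.+ 1 ≡ p ℤ.* ℤ.+ (suc d ℕ.* 1)
  cross = trans (ℤₚ.*-identityʳ _) (cong (p ℤ.*_) (cong ℤ.+_ (sym (ℕₚ.*-identityʳ (suc d)))))

∣i^n∣≡∣i∣^n : ∀ i n → ℤ.∣ i ℤ.^ n ∣ ≡ ℤ.∣ i ∣ ℕ.^ n
∣i^n∣≡∣i∣^n i zero = refl
∣i^n∣≡∣i∣^n i (suc n) = trans (ℤₚ.abs-* i (i ℤ.^ n)) (cong (ℤ.∣ i ∣ ℕ.*_) (∣i^n∣≡∣i∣^n i n))

coprime-∣^⇒≡1 : ∀ {a m} → Coprime a m → ∀ n → m ∣ℕ a ℕ.^ n → m ≡ 1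
coprime-∣^⇒≡1 a⊥m zero m∣1 = ∣1⇒≡1 m∣1
coprime-∣^⇒≡1 a⊥m (suc n) m∣aⁿ⁺¹ = coprime-∣^⇒≡1 a⊥m n (coprime-divisor (coprime-sym a⊥m) m∣aⁿ⁺¹)

module _ (p : ℤ) (d : ℕ) .(p⊥d : Coprime ℤ.∣ p ∣ (suc d)) where

  private
    y : ℚ
    y = mkℚ p d p⊥d
    q : ℤ
    q = ℤ.+ suc d

  lucasNumerator : ℕ → ℤ
  lucasNumerator zero = ℤ.+ 2
  lucasNumerator (suc zero) = p
  lucasNumerator (suc (suc k)) = p ℤ.* lucasNumerator (suc k) ℤ.- q ℤ.* q ℤ.* lucasNumerator k

  lucasV-numerator : ∀ k → fromℤ (q ℤ.^ k) * lucasV y k ≡ fromℤ (lucasNumerator k)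
  lucasV-numerator zero = refl
  lucasV-numerator (suc zero) = begin
    fromℤ (q ℤ.^ 1) * y   ≡⟨ cong (λ x → fromℤ x * y) (ℤₚ.^-identityʳ q) ⟩
    fromℤ q * y          ≡⟨ *-comm (fromℤ q) y ⟩
    y * fromℤ q          ≡⟨ mkℚ*denominator p d p⊥d ⟩
    fromℤ p              ∎
    where open ≡-Reasoning
  lucasV-numerator (suc (suc k)) = begin
    fromℤ (q ℤ.^ (2 ℕ.+ k)) * (y * V₁ - V₀)
      ≡⟨ cong (_* (y * V₁ - V₀)) (trans (sym (fromℤ-* q (q ℤ.^ suc k))) (cong (Q *_) (sym (fromℤ-* q (q ℤ.^ k))))) ⟩
    Q * (Q * Qᵏ) * (y * V₁ - V₀)
      ≡⟨ solve 5 (λ Q P y a b → Q :* (Q :* P) :* (y :* b :- a) := (y :* Q) :* (Q :* P :* b) :- (Q :* Q) :* (P :* a)) refl Q Qᵏ y V₀ V₁ ⟩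
    (y * Q) * (Q * Qᵏ * V₁) - (Q * Q) * (Qᵏ * V₀)
      ≡⟨ cong₂ (λ a b → a * (b * V₁) - Q * Q * (Qᵏ * V₀)) (mkℚ*denominator p d p⊥d) (fromℤ-* q (q ℤ.^ k)) ⟩
    fromℤ p * (fromℤ (q ℤ.^ suc k) * V₁) - Q * Q * (Qᵏ * V₀)
      ≡⟨ cong (λ a → fromℤ p * (fromℤ (q ℤ.^ suc k) * V₁) - a * (Qᵏ * V₀)) (fromℤ-* q q) ⟩
    fromℤ p * (fromℤ (q ℤ.^ suc k) * V₁) - fromℤ (q ℤ.* q) * (Qᵏ * V₀)
      ≡⟨ cong₂ (λ a b → fromℤ p * a - fromℤ (q ℤ.* q) * b) (lucasV-numerator (suc k)) (lucasV-numerator k) ⟩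
    fromℤ p * fromℤ N₁ - fromℤ (q ℤ.* q) * fromℤ N₀
      ≡⟨ trans (cong₂ _-_ (fromℤ-* p N₁) (fromℤ-* (q ℤ.* q) N₀)) (fromℤ-sub (p ℤ.* N₁) (q ℤ.* q ℤ.* N₀)) ⟩
    fromℤ (lucasNumerator (suc (suc k)))  ∎
    where
    open ≡-Reasoning
    Q Qᵏ V₀ V₁ : ℚ
    Q = fromℤ q
    Qᵏ = fromℤ (q ℤ.^ k)
    V₀ = lucasV y k
    V₁ = lucasV y (suc k)
    N₀ N₁ : ℤ
    N₀ = lucasNumerator k
    N₁ = lucasNumerator (suc k)

  lucasNumerator≡p^k : ∀ k → q ∣ℤ lucasNumerator (suc k) ℤ.- p ℤ.^ suc k
  lucasNumerator≡p^k zero = divides (ℤ.+ 0) (base p q)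
    where
    base : ∀ p q → p ℤ.- p ℤ.* ℤ.+ 1 ≡ ℤ.+ 0 ℤ.* q
    base = solve-∀
  lucasNumerator≡p^k (suc k) with lucasNumerator≡p^k k
  ... | divides t N-pᵏ≡tq = divides (p ℤ.* t ℤ.- q ℤ.* lucasNumerator k) (begin
    p ℤ.* N₁ ℤ.- q ℤ.* q ℤ.* N₀ ℤ.- p ℤ.* P  ≡⟨ regroup p N₁ N₀ P q ⟩
    p ℤ.* (N₁ ℤ.- P) ℤ.- q ℤ.* N₀ ℤ.* q      ≡⟨ cong (λ x → p ℤ.* x ℤ.- q ℤ.* N₀ ℤ.* q) N-pᵏ≡tq ⟩
    p ℤ.* (t ℤ.* q) ℤ.- q ℤ.* N₀ ℤ.* q       ≡⟨ factor p t q N₀ ⟩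
    (p ℤ.* t ℤ.- q ℤ.* N₀) ℤ.* q            ∎)
    where
    open ≡-Reasoning
    N₀ N₁ P : ℤ
    N₀ = lucasNumerator k
    N₁ = lucasNumerator (suc k)
    P = p ℤ.^ suc k
    regroup : ∀ p N₁ N₀ P q → p ℤ.* N₁ ℤ.- q ℤ.* q ℤ.* N₀ ℤ.- p ℤ.* P ≡ p ℤ.* (N₁ ℤ.- P) ℤ.- q ℤ.* N₀ ℤ.* q
    regroup = solve-∀
    factor : ∀ p t q N₀ → p ℤ.* (t ℤ.* q) ℤ.- q ℤ.* N₀ ℤ.* q ≡ (p ℤ.* t ℤ.- q ℤ.* N₀) ℤ.* q
    factor = solve-∀

  -- q^(k+1) V_{k+1}(y) ≡ p^(k+1) (mod q), so V_{k+1}(y) = 2 forces q ∣ p^(k+1), hence q = 1.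
  lucasV≡2⇒integral : ∀ k → lucasV y (suc k) ≡ 2ℚ → d ≡ 0
  lucasV≡2⇒integral k V≡2 = cong ℕ.pred (coprime-∣^⇒≡1 (recompute p⊥d) (suc k) q∣∣p∣ᵏ)
    where
    N≡2qᵏ : lucasNumerator (suc k) ≡ q ℤ.^ suc k ℤ.* ℤ.+ 2
    N≡2qᵏ = cong ↥_ (begin
      fromℤ (lucasNumerator (suc k))           ≡⟨ lucasV-numerator (suc k) ⟨
      fromℤ (q ℤ.^ suc k) * lucasV y (suc k)   ≡⟨ cong (fromℤ (q ℤ.^ suc k) *_) V≡2 ⟩
      fromℤ (q ℤ.^ suc k) * fromℤ (ℤ.+ 2)        ≡⟨ fromℤ-* (q ℤ.^ suc k) (ℤ.+ 2) ⟩
      fromℤ (q ℤ.^ suc k ℤ.* ℤ.+ 2)              ∎)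
      where open ≡-Reasoning
    q∣pᵏ : q ∣ℤ p ℤ.^ suc k
    q∣pᵏ with lucasNumerator≡p^k k
    ... | divides t N-pᵏ≡tq = divides (q ℤ.^ k ℤ.* ℤ.+ 2 ℤ.- t) (begin
      p ℤ.^ suc k                                              ≡⟨ swap (p ℤ.^ suc k) (lucasNumerator (suc k)) ⟩
      lucasNumerator (suc k) ℤ.- (lucasNumerator (suc k) ℤ.- p ℤ.^ suc k) ≡⟨ cong₂ ℤ._-_ N≡2qᵏ N-pᵏ≡tq ⟩
      q ℤ.* q ℤ.^ k ℤ.* ℤ.+ 2 ℤ.- t ℤ.* q                        ≡⟨ factor q (q ℤ.^ k) t ⟩
      (q ℤ.^ k ℤ.* ℤ.+ 2 ℤ.- t) ℤ.* q                            ∎)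
      where
      open ≡-Reasoning
      swap : ∀ P N → P ≡ N ℤ.- (N ℤ.- P)
      swap = solve-∀
      factor : ∀ q Q t → q ℤ.* Q ℤ.* ℤ.+ 2 ℤ.- t ℤ.* q ≡ (Q ℤ.* ℤ.+ 2 ℤ.- t) ℤ.* q
      factor = solve-∀
    q∣∣p∣ᵏ : suc d ∣ℕ ℤ.∣ p ∣ ℕ.^ suc k
    q∣∣p∣ᵏ = subst (suc d ∣ℕ_) (∣i^n∣≡∣i∣^n p (suc k)) (∣⇒∣ᵤ q∣pᵏ)

niven : ∀ y k → lucasV y (suc k) ≡ 2ℚ → y * (y * y - 1ℚ) * (y * y - 4ℚ) ≡ 0ℚ
niven (mkℚ p d p⊥d) k V≡2 with lucasV≡2⇒integral p d p⊥d k V≡2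
niven (mkℚ (ℤ.+ 0) .0 _) k V≡2 | refl = refl
niven (mkℚ (ℤ.+ 1) .0 _) k V≡2 | refl = refl
niven (mkℚ (ℤ.+ 2) .0 _) k V≡2 | refl = refl
niven (mkℚ (ℤ.+ suc (suc (suc n))) .0 _) k V≡2 | refl = ⊥-elim (lucasV≢2-large (*<* (ℤ.+<+ (s≤s (s≤s (s≤s z≤n))))) k V≡2)
niven (mkℚ ℤ.-[1+ 0 ] .0 _) k V≡2 | refl = refl
niven (mkℚ ℤ.-[1+ 1 ] .0 _) k V≡2 | refl = refl
niven (mkℚ ℤ.-[1+ suc (suc n) ] .0 _) k V≡2 | refl = ⊥-elim (lucasV≢2-small (*<* (ℤ.-<- (s≤s (s≤s z≤n)))) k V≡2)

-- Self-adjoint operators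

module Reversible {n : ℕ} (T : Matrix n) (π : Fin n → ℚ) (π>0 : ∀ v → 0ℚ < π v)
                  (balance : ∀ u v → π u * T u v ≡ π v * T v u) where

  open Action T

  ⟨_,_⟩ : ℚⁿ → ℚⁿ → ℚ
  ⟨ y , z ⟩ = ∑[ v < n ] (π v * (y v * z v))

  ⟨⟩-congʳ : ∀ y {z z′} → z ≗ z′ → ⟨ y , z ⟩ ≡ ⟨ y , z′ ⟩
  ⟨⟩-congʳ y z≗z′ = sum-cong-≗ λ v → cong (λ a → π v * (y v * a)) (z≗z′ v)

  ⟨⟩-linearˡ : ∀ c y y′ z → ⟨ c ·ᵥ y +ᵥ y′ , z ⟩ ≡ c * ⟨ y , z ⟩ + ⟨ y′ , z ⟩
  ⟨⟩-linearˡ c y y′ z = begin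
    ∑[ v < n ] (π v * ((c * y v + y′ v) * z v))
      ≡⟨ sum-cong-≗ (λ v → distrib (π v) c (y v) (y′ v) (z v)) ⟩
    ∑[ v < n ] (c * (π v * (y v * z v)) + π v * (y′ v * z v))
      ≡⟨ ∑-distrib-+ (λ v → c * (π v * (y v * z v))) (λ v → π v * (y′ v * z v)) ⟩
    ∑[ v < n ] (c * (π v * (y v * z v))) + ⟨ y′ , z ⟩
      ≡⟨ cong (_+ ⟨ y′ , z ⟩) (∑-*ˡ c (λ v → π v * (y v * z v))) ⟩
    c * ⟨ y , z ⟩ + ⟨ y′ , z ⟩ ∎
    where
    open ≡-Reasoning
    distrib : ∀ p c y y′ z → p * ((c * y + y′) * z) ≡ c * (p * (y * z)) + p * (y′ * z)
    distrib = solve 5 (λ p c y y′ z → p :* ((c :* y :+ y′) :* z) := c :* (p :* (y :* z)) :+ p :* (y′ :* z)) refl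

  ⟨⟩-comm : ∀ y z → ⟨ y , z ⟩ ≡ ⟨ z , y ⟩
  ⟨⟩-comm y z = sum-cong-≗ λ v → cong (π v *_) (*-comm (y v) (z v))

  ⟨⟩-linearʳ : ∀ c y z z′ → ⟨ y , c ·ᵥ z +ᵥ z′ ⟩ ≡ c * ⟨ y , z ⟩ + ⟨ y , z′ ⟩
  ⟨⟩-linearʳ c y z z′ = trans (⟨⟩-comm y (c ·ᵥ z +ᵥ z′))
    (trans (⟨⟩-linearˡ c z z′ y) (cong₂ (λ a b → c * a + b) (⟨⟩-comm z y) (⟨⟩-comm z′ y)))

  ⟨⟩-0ʳ : ∀ y → ⟨ y , 0ᵥ ⟩ ≡ 0ℚ
  ⟨⟩-0ʳ y = trans (sum-cong-≗ λ v → trans (cong (π v *_) (*-zeroʳ (y v))) (*-zeroʳ (π v))) (∑-zero n)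

  ⟨apply⟩ : ∀ y z → ⟨ apply y , z ⟩ ≡ ⟨ y , apply z ⟩
  ⟨apply⟩ y z = begin
    ∑[ v < n ] (π v * (∑[ c < n ] (T v c * y c) * z v))
      ≡⟨ sum-cong-≗ (λ v → trans (cong (π v *_) (sym (∑-*ʳ (z v) (λ c → T v c * y c))))
                                 (sym (∑-*ˡ (π v) (λ c → T v c * y c * z v)))) ⟩
    ∑[ v < n ] ∑[ c < n ] (π v * (T v c * y c * z v))
      ≡⟨ sum-cong-≗ (λ v → sum-cong-≗ λ c → swapped v c) ⟩
    ∑[ v < n ] ∑[ c < n ] (π c * (y c * (T c v * z v)))
      ≡⟨ ∑-comm (λ v c → π c * (y c * (T c v * z v))) ⟩
    ∑[ c < n ] ∑[ v < n ] (π c * (y c * (T c v * z v)))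
      ≡⟨ sum-cong-≗ (λ c → trans (∑-*ˡ (π c) (λ v → y c * (T c v * z v)))
                                 (cong (π c *_) (∑-*ˡ (y c) (λ v → T c v * z v)))) ⟩
    ∑[ c < n ] (π c * (y c * ∑[ v < n ] (T c v * z v)))  ∎
    where
    open ≡-Reasoning
    swapped : ∀ v c → π v * (T v c * y c * z v) ≡ π c * (y c * (T c v * z v))
    swapped v c = begin
      π v * (T v c * y c * z v)     ≡⟨ solve 4 (λ p t y z → p :* (t :* y :* z) := (p :* t) :* (y :* z)) refl (π v) (T v c) (y c) (z v) ⟩
      (π v * T v c) * (y c * z v)   ≡⟨ cong (_* (y c * z v)) (balance v c) ⟩
      (π c * T c v) * (y c * z v)   ≡⟨ solve 4 (λ p t y z → (p :* t) :* (y :* z) := p :* (y :* (t :* z))) refl (π c) (T c v) (y c) (z v) ⟩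
      π c * (y c * (T c v * z v))   ∎

  ⟨act⟩ : ∀ p y z → ⟨ act p y , z ⟩ ≡ ⟨ y , act p z ⟩
  ⟨act⟩ [] y z = trans (⟨⟩-comm 0ᵥ z) (trans (⟨⟩-0ʳ z) (sym (⟨⟩-0ʳ y)))
  ⟨act⟩ (a ∷ p) y z = begin
    ⟨ a ·ᵥ y +ᵥ apply (act p y) , z ⟩     ≡⟨ ⟨⟩-linearˡ a y (apply (act p y)) z ⟩
    a * ⟨ y , z ⟩ + ⟨ apply (act p y) , z ⟩ ≡⟨ cong (a * ⟨ y , z ⟩ +_) (⟨apply⟩ (act p y) z) ⟩
    a * ⟨ y , z ⟩ + ⟨ act p y , apply z ⟩   ≡⟨ cong (a * ⟨ y , z ⟩ +_) (⟨act⟩ p y (apply z)) ⟩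
    a * ⟨ y , z ⟩ + ⟨ y , act p (apply z) ⟩ ≡⟨ cong (a * ⟨ y , z ⟩ +_) (⟨⟩-congʳ y (act-apply p z)) ⟩
    a * ⟨ y , z ⟩ + ⟨ y , apply (act p z) ⟩ ≡⟨ ⟨⟩-linearʳ a y z (apply (act p z)) ⟨
    ⟨ y , a ·ᵥ z +ᵥ apply (act p z) ⟩     ∎
    where open ≡-Reasoning

  ⟨z,z⟩≡0⇒z≗0 : ∀ z → ⟨ z , z ⟩ ≡ 0ℚ → z ≗ 0ᵥ
  ⟨z,z⟩≡0⇒z≗0 z ⟨z,z⟩≡0 v = x*x≡0⇒x≡0 (z v) (*-cancelˡ-≡0 (π v) (z v * z v) (≢-sym (<⇒≢ (π>0 v)))
    (∑-nonNeg-≡0 (λ v → π v * (z v * z v)) (λ v → 0≤p*q (<⇒≤ (π>0 v)) (0≤p*p (z v))) ⟨z,z⟩≡0 v))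

  -- Peel off one linear factor at a time: z = q(T) w is then a μ-eigenvector, and if q(μ) = 0
  -- then ⟨z, z⟩ = ⟨w, q(T) z⟩ = 0.
  annihilate : ∀ q → (∀ μ z → apply z ≗ μ ·ᵥ z → eval μ q ≡ 0ℚ ⊎ z ≗ 0ᵥ) →
               ∀ {k} (μs : Vec ℚ k) w → act (prodLinear μs) w ≗ 0ᵥ → act q w ≗ 0ᵥ
  annihilate q spectral [] w 1w≗0 v = trans (act-cong q w≗0 v) (act-0 q v)
    where
    w≗0 : w ≗ 0ᵥ
    w≗0 v = trans (sym (*-identityˡ (w v))) (trans (sym (act-constP 1ℚ w v)) (1w≗0 v))
  annihilate q spectral (μ ∷ μs) w ∏w≗0 = eigenvector≗0 (spectral μ z Tz≗μz)
    where
    L : Poly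
    L = X ⊕ constP (- μ)
    z : ℚⁿ
    z = act q w
    Lz≗0 : act L z ≗ 0ᵥ
    Lz≗0 v = trans (act-comm L q w v) (annihilate q spectral μs (act L w) (λ v′ →
      trans (act-comm (prodLinear μs) L w v′) (trans (sym (act-⊗ L (prodLinear μs) w v′)) (∏w≗0 v′))) v)
    Tz≗μz : apply z ≗ μ ·ᵥ z
    Tz≗μz v = begin
      apply z v                                   ≡⟨ solve 3 (λ t μ x → t := (t :+ (:- μ) :* x) :+ μ :* x) refl (apply z v) μ (z v) ⟩
      (apply z v + - μ * z v) + μ * z v           ≡⟨ cong (_+ μ * z v) (sym (cong₂ _+_ (act-X z v) (act-constP (- μ) z v))) ⟩
      (act X z v + act (constP (- μ)) z v) + μ * z v ≡⟨ cong (_+ μ * z v) (trans (sym (act-⊕ X (constP (- μ)) z v)) (Lz≗0 v)) ⟩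
      0ℚ + μ * z v                                ≡⟨ +-identityˡ (μ * z v) ⟩
      μ * z v                                     ∎
      where open ≡-Reasoning
    eigenvector≗0 : eval μ q ≡ 0ℚ ⊎ z ≗ 0ᵥ → z ≗ 0ᵥ
    eigenvector≗0 (inj₂ z≗0) = z≗0
    eigenvector≗0 (inj₁ qμ≡0) = ⟨z,z⟩≡0⇒z≗0 z (begin
      ⟨ act q w , z ⟩       ≡⟨ ⟨act⟩ q w z ⟩
      ⟨ w , act q z ⟩       ≡⟨ ⟨⟩-congʳ w (λ v → trans (act-eigen Tz≗μz q v) (trans (cong (_* z v) qμ≡0) (*-zeroˡ (z v)))) ⟩
      ⟨ w , 0ᵥ ⟩            ≡⟨ ⟨⟩-0ʳ w ⟩
      0ℚ                    ∎)
      where open ≡-Reasoning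

-- The Grover recursion and Chebyshev polynomials

terminalCoeff originCoeff : ℚ → ℕ → ℚ
terminalCoeff μ zero = 1ℚ
terminalCoeff μ (suc m) = - originCoeff μ m
originCoeff μ zero = 0ℚ
originCoeff μ (suc m) = terminalCoeff μ m + 2ℚ * (μ * originCoeff μ m)

chebyshevCoeff : ℚ → ℕ → ℚ
chebyshevCoeff μ m = terminalCoeff μ m + μ * originCoeff μ m

lucasV≡2*chebyshevCoeff : ∀ μ m → lucasV (2ℚ * μ) m ≡ 2ℚ * chebyshevCoeff μ m
lucasV≡2*chebyshevCoeff μ zero = solve 1 (λ μ → con 2ℚ := con 2ℚ :* (con 1ℚ :+ μ :* con 0ℚ)) refl μ
lucasV≡2*chebyshevCoeff μ (suc zero) =
  solve 1 (λ μ → con 2ℚ :* μ := con 2ℚ :* (:- con 0ℚ :+ μ :* (con 1ℚ :+ con 2ℚ :* (μ :* con 0ℚ)))) refl μ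
lucasV≡2*chebyshevCoeff μ (suc (suc m)) = begin
  2ℚ * μ * lucasV (2ℚ * μ) (suc m) - lucasV (2ℚ * μ) m
    ≡⟨ cong₂ (λ x y → 2ℚ * μ * x - y) (lucasV≡2*chebyshevCoeff μ (suc m)) (lucasV≡2*chebyshevCoeff μ m) ⟩
  2ℚ * μ * (2ℚ * chebyshevCoeff μ (suc m)) - 2ℚ * chebyshevCoeff μ m
    ≡⟨ recurrence μ (terminalCoeff μ m) (originCoeff μ m) ⟩
  2ℚ * chebyshevCoeff μ (2 ℕ.+ m) ∎
  where
  open ≡-Reasoning
  recurrence : ∀ μ a b → 2ℚ * μ * (2ℚ * (- b + μ * (a + 2ℚ * (μ * b)))) - 2ℚ * (a + μ * b)
                         ≡ 2ℚ * (- (a + 2ℚ * (μ * b)) + μ * (- b + 2ℚ * (μ * (a + 2ℚ * (μ * b)))))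
  recurrence = solve 3 (λ μ a b →
    con 2ℚ :* μ :* (con 2ℚ :* (:- b :+ μ :* (a :+ con 2ℚ :* (μ :* b)))) :- con 2ℚ :* (a :+ μ :* b)
      := con 2ℚ :* (:- (a :+ con 2ℚ :* (μ :* b)) :+ μ :* (:- b :+ con 2ℚ :* (μ :* (a :+ con 2ℚ :* (μ :* b)))))) refl

module GroverSequences {n : ℕ} (T : Matrix n) where

  open Action T

  terminal origin : ℕ → ℚⁿ → ℚⁿ
  terminal zero x = x
  terminal (suc m) x v = - origin m x v
  origin zero x = 0ᵥ
  origin (suc m) x = terminal m x +ᵥ 2ℚ ·ᵥ apply (origin m x)

  grover-eigen : ∀ {μ z} → apply z ≗ μ ·ᵥ z → ∀ m →
                 terminal m z ≗ terminalCoeff μ m ·ᵥ z × origin m z ≗ originCoeff μ m ·ᵥ z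
  grover-eigen {μ} {z} Tz≗μz zero = (λ v → sym (*-identityˡ (z v))) , (λ v → sym (*-zeroˡ (z v)))
  grover-eigen {μ} {z} Tz≗μz (suc m) = terminal≗ , origin≗
    where
    a b : ℚ
    a = terminalCoeff μ m
    b = originCoeff μ m
    IH : terminal m z ≗ a ·ᵥ z × origin m z ≗ b ·ᵥ z
    IH = grover-eigen Tz≗μz m
    terminal≗ : terminal (suc m) z ≗ (- b) ·ᵥ z
    terminal≗ v = trans (cong -_ (proj₂ IH v)) (neg-distribˡ-* b (z v))
    origin≗ : origin (suc m) z ≗ (a + 2ℚ * (μ * b)) ·ᵥ z
    origin≗ v = begin
      terminal m z v + 2ℚ * apply (origin m z) v
        ≡⟨ cong₂ (λ x y → x + 2ℚ * y) (proj₁ IH v) (apply-eigen μ b Tz≗μz (proj₂ IH) v) ⟩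
      a * z v + 2ℚ * (b * (μ * z v))
        ≡⟨ solve 4 (λ a b μ x → a :* x :+ con 2ℚ :* (b :* (μ :* x)) := (a :+ con 2ℚ :* (μ :* b)) :* x) refl a b μ (z v) ⟩
      (a + 2ℚ * (μ * b)) * z v ∎
      where open ≡-Reasoning

  chebyshev-eigen : ∀ {μ z} → apply z ≗ μ ·ᵥ z → ∀ m → terminal m z +ᵥ apply (origin m z) ≗ chebyshevCoeff μ m ·ᵥ z
  chebyshev-eigen {μ} {z} Tz≗μz m v = begin
    terminal m z v + apply (origin m z) v
      ≡⟨ cong₂ _+_ (proj₁ eigen v) (apply-eigen μ b Tz≗μz (proj₂ eigen) v) ⟩
    a * z v + b * (μ * z v)
      ≡⟨ solve 4 (λ a b μ x → a :* x :+ b :* (μ :* x) := (a :+ μ :* b) :* x) refl a b μ (z v) ⟩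
    (a + μ * b) * z v ∎
    where
    open ≡-Reasoning
    a b : ℚ
    a = terminalCoeff μ m
    b = originCoeff μ m
    eigen : terminal m z ≗ a ·ᵥ z × origin m z ≗ b ·ᵥ z
    eigen = grover-eigen Tz≗μz m


-- Graphs and the Grover walk

sumOver-arcs : ∀ G (f : Pair G → ℚ) →
  sumOver (arcs G) f ≡ ∑[ u < n G ] ∑[ v < n G ] (if adj G u v then f (u , v) else 0ℚ)
sumOver-arcs G f = begin
  sumOver (arcs G) f
    ≡⟨ sumOver-filter (λ e → adj G (proj₁ e) (proj₂ e)) pairs f ⟩
  sumOver pairs f∣arcs
    ≡⟨ sumOver-concatMap (λ u → map (u ,_) (allFin (n G))) (allFin (n G)) f∣arcs ⟩
  sumOver (allFin (n G)) (λ u → sumOver (map (u ,_) (allFin (n G))) f∣arcs)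
    ≡⟨ sumOver-allFin (n G) (λ u → sumOver (map (u ,_) (allFin (n G))) f∣arcs) ⟩
  ∑[ u < n G ] sumOver (map (u ,_) (allFin (n G))) f∣arcs
    ≡⟨ sum-cong-≗ (λ u → trans (sumOver-map (u ,_) (allFin (n G)) f∣arcs) (sumOver-allFin (n G) (λ v → f∣arcs (u , v)))) ⟩
  ∑[ u < n G ] ∑[ v < n G ] (if adj G u v then f (u , v) else 0ℚ) ∎
  where
  open ≡-Reasoning
  pairs : List (Pair G)
  pairs = concatMap (λ u → map (u ,_) (allFin (n G))) (allFin (n G))
  f∣arcs : Pair G → ℚ
  f∣arcs e = if adj G (proj₁ e) (proj₂ e) then f e else 0ℚ

module _ (G : Graph) where

  adjℚ : Fin (n G) → Fin (n G) → ℚ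
  adjℚ u v = if adj G u v then 1ℚ else 0ℚ

  degℚ : Fin (n G) → ℚ
  degℚ u = fromℤ (ℤ.+ deg G u)

  degℚ≡∑adjℚ : ∀ u → degℚ u ≡ ∑[ v < n G ] adjℚ u v
  degℚ≡∑adjℚ u = trans (count (allFin (n G))) (sumOver-allFin (n G) (adjℚ u))
    where
    countAdj : List (Fin (n G)) → ℕ
    countAdj = foldr (λ v k → if adj G u v then suc k else k) 0
    count : ∀ vs → fromℤ (ℤ.+ countAdj vs) ≡ sumOver vs (adjℚ u)
    count [] = refl
    count (v ∷ vs) with adj G u v
    ... | true = trans (sym (fromℤ-+ (ℤ.+ 1) (ℤ.+ countAdj vs))) (cong (1ℚ +_) (count vs))
    ... | false = trans (count vs) (sym (+-identityˡ _))

  adj⇒deg≢0 : ∀ {u v} → adj G u v ≡ true → deg G u ≢ 0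
  adj⇒deg≢0 {u} {v} uv deg≡0 = <-irrefl refl (begin-strict
    0ℚ                       <⟨ from-yes (0ℚ <? 1ℚ) ⟩
    1ℚ                       ≡⟨ cong (λ b → if b then 1ℚ else 0ℚ) uv ⟨
    adjℚ u v                 ≤⟨ term≤∑ (adjℚ u) adjℚ-nonNeg v ⟩
    ∑[ w < n G ] adjℚ u w    ≡⟨ degℚ≡∑adjℚ u ⟨
    degℚ u                   ≡⟨ cong (λ d → fromℤ (ℤ.+ d)) deg≡0 ⟩
    0ℚ                       ∎)
    where
    open ≤-Reasoning
    adjℚ-nonNeg : ∀ w → 0ℚ ≤ adjℚ u w
    adjℚ-nonNeg w with adj G u w
    ... | true = from-yes (0ℚ ≤? 1ℚ)
    ... | false = ≤-refl

  connected-isolated⇒trivial : Connected G → ∀ {w} → deg G w ≡ 0 → ∀ x → x ≡ w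
  connected-isolated⇒trivial connected {w} deg≡0 x with connected w x
  ... | .0 , nil = refl
  ... | .(suc _) , cons wv _ = ⊥-elim (adj⇒deg≢0 wv deg≡0)

-- x(x² − ¼)(x² − 1), whose roots 0, ±½, ±1 are the rational values of cos(2πr).
rationalCosines : Poly
rationalCosines = 0ℚ ∷ ℤ.+ 1 / 4 ∷ 0ℚ ∷ - (ℤ.+ 5 / 4) ∷ 0ℚ ∷ 1ℚ ∷ []

lucasV≡2⇒rationalCosines-root : ∀ μ k → lucasV (2ℚ * μ) (suc k) ≡ 2ℚ → eval μ rationalCosines ≡ 0ℚ
lucasV≡2⇒rationalCosines-root μ k V≡2 = begin
  eval μ rationalCosines
    ≡⟨ solve 1 (λ μ →
         con 0ℚ :+ μ :* (con (ℤ.+ 1 / 4) :+ μ :* (con 0ℚ :+ μ :* (con (- (ℤ.+ 5 / 4)) :+ μ :* (con 0ℚ :+ μ :* (con 1ℚ :+ μ :* con 0ℚ)))))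
           := con (ℤ.+ 1 / 32) :* ((con 2ℚ :* μ) :* ((con 2ℚ :* μ) :* (con 2ℚ :* μ) :- con 1ℚ)
                                   :* ((con 2ℚ :* μ) :* (con 2ℚ :* μ) :- con 4ℚ))) refl μ ⟩
  ℤ.+ 1 / 32 * (y * (y * y - 1ℚ) * (y * y - 4ℚ))
    ≡⟨ cong (ℤ.+ 1 / 32 *_) (niven y k V≡2) ⟩
  ℤ.+ 1 / 32 * 0ℚ
    ≡⟨ *-zeroʳ (ℤ.+ 1 / 32) ⟩
  0ℚ ∎
  where
  open ≡-Reasoning
  y : ℚ
  y = 2ℚ * μ

module Grover (G : Graph) (deg≢0 : ∀ v → deg G v ≢ 0) where

  T : Matrix (n G)
  T = transition G

  open Action T
  open GroverSequences T

  inv-deg*degℚ : ∀ u → inv (deg G u) * degℚ G u ≡ 1ℚ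
  inv-deg*degℚ u with deg G u | deg≢0 u
  ... | zero | deg≢0ᵤ = ⊥-elim (deg≢0ᵤ refl)
  ... | suc d | _ = trans (cong (_* fromℤ (ℤ.+ suc d)) (normalize-coprime (1-coprimeTo (suc d)))) (*-inverseˡ (fromℤ (ℤ.+ suc d)))

  0<inv-deg : ∀ u → 0ℚ < inv (deg G u)
  0<inv-deg u with deg G u | deg≢0 u
  ... | zero | deg≢0ᵤ = ⊥-elim (deg≢0ᵤ refl)
  ... | suc d | _ = subst (0ℚ <_) (sym (normalize-coprime (1-coprimeTo (suc d)))) (*<* (ℤ.+<+ (s≤s z≤n)))

  0<degℚ : ∀ u → 0ℚ < degℚ G u
  0<degℚ u with deg G u | deg≢0 u
  ... | zero | deg≢0ᵤ = ⊥-elim (deg≢0ᵤ refl)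
  ... | suc d | _ = *<* (ℤ.+<+ (s≤s z≤n))

  transition≡inv*adjℚ : ∀ u v → T u v ≡ inv (deg G u) * adjℚ G u v
  transition≡inv*adjℚ u v with adj G u v
  ... | true = sym (*-identityʳ (inv (deg G u)))
  ... | false = sym (*-zeroʳ (inv (deg G u)))

  transition-rowSum : ∀ u → ∑[ v < n G ] T u v ≡ 1ℚ
  transition-rowSum u = begin
    ∑[ v < n G ] T u v                           ≡⟨ sum-cong-≗ (transition≡inv*adjℚ u) ⟩
    ∑[ v < n G ] (inv (deg G u) * adjℚ G u v)    ≡⟨ ∑-*ˡ (inv (deg G u)) (adjℚ G u) ⟩
    inv (deg G u) * ∑[ v < n G ] adjℚ G u v      ≡⟨ cong (inv (deg G u) *_) (degℚ≡∑adjℚ G u) ⟨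
    inv (deg G u) * degℚ G u                     ≡⟨ inv-deg*degℚ u ⟩
    1ℚ                                           ∎
    where open ≡-Reasoning

  transition-nonNeg : ∀ u v → 0ℚ ≤ T u v
  transition-nonNeg u v with adj G u v
  ... | true = <⇒≤ (0<inv-deg u)
  ... | false = ≤-refl

  adj⇒0<transition : ∀ {u v} → adj G u v ≡ true → 0ℚ < T u v
  adj⇒0<transition {u} {v} uv rewrite uv = 0<inv-deg u

  transition≢0⇒adj : ∀ {u v} → T u v ≢ 0ℚ → adj G u v ≡ true
  transition≢0⇒adj {u} {v} Tuv≢0 with adj G u v
  ... | true = refl
  ... | false = ⊥-elim (Tuv≢0 refl)

  detailed-balance : ∀ u v → degℚ G u * T u v ≡ degℚ G v * T v u
  detailed-balance u v = begin
    degℚ G u * T u v                          ≡⟨ cong (degℚ G u *_) (transition≡inv*adjℚ u v) ⟩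
    degℚ G u * (inv (deg G u) * adjℚ G u v)   ≡⟨ cancel (degℚ G u) (inv (deg G u)) (adjℚ G u v) (inv-deg*degℚ u) ⟩
    adjℚ G u v                                ≡⟨ cong (λ b → if b then 1ℚ else 0ℚ) (adj-sym G u v) ⟩
    adjℚ G v u                                ≡⟨ cancel (degℚ G v) (inv (deg G v)) (adjℚ G v u) (inv-deg*degℚ v) ⟨
    degℚ G v * (inv (deg G v) * adjℚ G v u)   ≡⟨ cong (degℚ G v *_) (transition≡inv*adjℚ v u) ⟨
    degℚ G v * T v u                          ∎
    where
    open ≡-Reasoning
    cancel : ∀ d i a → i * d ≡ 1ℚ → d * (i * a) ≡ a
    cancel d i a i*d≡1 = trans (solve 3 (λ d i a → d :* (i :* a) := (i :* d) :* a) refl d i a)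
                                     (trans (cong (_* a) i*d≡1) (*-identityˡ a))

  infixr 5 _▷_

  _▷_ : ArcMatrix G → (Pair G → ℚ) → Pair G → ℚ
  (A ▷ ψ) e = sumOver (arcs G) (λ g → A e g * ψ g)

  mulArc-▷ : ∀ A B ψ e → (mulArc G A B ▷ ψ) e ≡ (A ▷ B ▷ ψ) e
  mulArc-▷ A B ψ e = begin
    sumOver (arcs G) (λ g → sumOver (arcs G) (λ h → A e h * B h g) * ψ g)
      ≡⟨ sumOver-lookup (arcs G) (λ g → sumOver (arcs G) (λ h → A e h * B h g) * ψ g) ⟩
    ∑[ i < L ] (sumOver (arcs G) (λ h → A e h * B h (arc i)) * ψ (arc i))
      ≡⟨ sum-cong-≗ (λ i → cong (_* ψ (arc i)) (sumOver-lookup (arcs G) (λ h → A e h * B h (arc i)))) ⟩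
    ∑[ i < L ] (∑[ j < L ] (A e (arc j) * B (arc j) (arc i)) * ψ (arc i))
      ≡⟨ sum-cong-≗ (λ i → trans (sym (∑-*ʳ (ψ (arc i)) (λ j → A e (arc j) * B (arc j) (arc i))))
                                 (sum-cong-≗ λ j → *-assoc (A e (arc j)) (B (arc j) (arc i)) (ψ (arc i)))) ⟩
    ∑[ i < L ] ∑[ j < L ] (A e (arc j) * (B (arc j) (arc i) * ψ (arc i)))
      ≡⟨ ∑-comm (λ i j → A e (arc j) * (B (arc j) (arc i) * ψ (arc i))) ⟩
    ∑[ j < L ] ∑[ i < L ] (A e (arc j) * (B (arc j) (arc i) * ψ (arc i)))
      ≡⟨ sum-cong-≗ (λ j → ∑-*ˡ (A e (arc j)) (λ i → B (arc j) (arc i) * ψ (arc i))) ⟩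
    ∑[ j < L ] (A e (arc j) * ∑[ i < L ] (B (arc j) (arc i) * ψ (arc i)))
      ≡⟨ sum-cong-≗ (λ j → cong (A e (arc j) *_) (sumOver-lookup (arcs G) (λ g → B (arc j) g * ψ g))) ⟨
    ∑[ j < L ] (A e (arc j) * (B ▷ ψ) (arc j))
      ≡⟨ sumOver-lookup (arcs G) (λ h → A e h * (B ▷ ψ) h) ⟨
    (A ▷ B ▷ ψ) e ∎
    where
    open ≡-Reasoning
    L : ℕ
    L = length (arcs G)
    arc : Fin L → Pair G
    arc = lookup (arcs G)

  sumOver-arcs-cong : ∀ {f g : Pair G → ℚ} → (∀ c d → adj G c d ≡ true → f (c , d) ≡ g (c , d)) →
                      sumOver (arcs G) f ≡ sumOver (arcs G) g
  sumOver-arcs-cong {f} {g} f≡g = trans (sumOver-arcs G f) (trans (sum-cong-≗ λ c → sum-cong-≗ λ d → onArc c d) (sym (sumOver-arcs G g)))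
    where
    onArc : ∀ c d → (if adj G c d then f (c , d) else 0ℚ) ≡ (if adj G c d then g (c , d) else 0ℚ)
    onArc c d with adj G c d in cd
    ... | true = f≡g c d cd
    ... | false = refl

  idArc-▷ : ∀ ψ {a b} → adj G a b ≡ true → (idArc G ▷ ψ) (a , b) ≡ ψ (a , b)
  idArc-▷ ψ {a} {b} ab = begin
    (idArc G ▷ ψ) (a , b)
      ≡⟨ sumOver-arcs G (λ g → idArc G (a , b) g * ψ g) ⟩
    ∑[ c < n G ] ∑[ d < n G ] (if adj G c d then idArc G (a , b) (c , d) * ψ (c , d) else 0ℚ)
      ≡⟨ sum-cong-≗ (λ c → trans (sum-cong-≗ (sift c)) (∑-*ˡ (δ a c) (λ d → δ b d * ψ∣arcs c d))) ⟩
    ∑[ c < n G ] (δ a c * ∑[ d < n G ] (δ b d * ψ∣arcs c d))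
      ≡⟨ ∑-δˡ a (λ c → ∑[ d < n G ] (δ b d * ψ∣arcs c d)) ⟩
    ∑[ d < n G ] (δ b d * ψ∣arcs a d)
      ≡⟨ ∑-δˡ b (ψ∣arcs a) ⟩
    ψ∣arcs a b
      ≡⟨ cong (λ x → if x then ψ (a , b) else 0ℚ) ab ⟩
    ψ (a , b) ∎
    where
    open ≡-Reasoning
    ψ∣arcs : Fin (n G) → Fin (n G) → ℚ
    ψ∣arcs c d = if adj G c d then ψ (c , d) else 0ℚ
    sift : ∀ c d → (if adj G c d then idArc G (a , b) (c , d) * ψ (c , d) else 0ℚ) ≡ δ a c * (δ b d * ψ∣arcs c d)
    sift c d with eqᶠ a c | eqᶠ b d | adj G c d
    ... | true  | true  | true  = solve 1 (λ x → con 1ℚ :* x := con 1ℚ :* (con 1ℚ :* x)) refl (ψ (c , d))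
    ... | true  | true  | false = refl
    ... | true  | false | true  = solve 1 (λ x → con 0ℚ :* x := con 1ℚ :* (con 0ℚ :* x)) refl (ψ (c , d))
    ... | true  | false | false = refl
    ... | false | b≟d  | true  = trans (*-zeroˡ (ψ (c , d))) (sym (*-zeroˡ ((if b≟d then 1ℚ else 0ℚ) * ψ (c , d))))
    ... | false | b≟d  | false = sym (*-zeroˡ ((if b≟d then 1ℚ else 0ℚ) * 0ℚ))

  liftArc : ℚⁿ → ℚⁿ → Pair G → ℚ
  liftArc α β (c , d) = α d + β c

  grover-▷-liftArc : ∀ α β {a b} → adj G a b ≡ true →
    (grover G ▷ liftArc α β) (a , b) ≡ liftArc (λ v → - β v) (α +ᵥ 2ℚ ·ᵥ apply β) (a , b)
  grover-▷-liftArc α β {a} {b} ab = begin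
    (grover G ▷ liftArc α β) (a , b)
      ≡⟨ sumOver-arcs G (λ g → grover G (a , b) g * liftArc α β g) ⟩
    ∑[ c < n G ] ∑[ d < n G ] (if adj G c d then grover G (a , b) (c , d) * (α d + β c) else 0ℚ)
      ≡⟨ sum-cong-≗ (λ c → trans (sum-cong-≗ (sift c)) (∑-δʳ a (incoming c))) ⟩
    ∑[ c < n G ] incoming c a
      ≡⟨ sum-cong-≗ outgoing ⟩
    ∑[ c < n G ] (2ℚ * α a * T a c + 2ℚ * (T a c * β c) - δ b c * (α a + β c))
      ≡⟨ ∑-distrib-+ (λ c → 2ℚ * α a * T a c + 2ℚ * (T a c * β c)) (λ c → - (δ b c * (α a + β c))) ⟩
    ∑[ c < n G ] (2ℚ * α a * T a c + 2ℚ * (T a c * β c)) + ∑[ c < n G ] (- (δ b c * (α a + β c)))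
      ≡⟨ cong₂ _+_ (∑-distrib-+ (λ c → 2ℚ * α a * T a c) (λ c → 2ℚ * (T a c * β c))) (∑-neg (λ c → δ b c * (α a + β c))) ⟩
    ∑[ c < n G ] (2ℚ * α a * T a c) + ∑[ c < n G ] (2ℚ * (T a c * β c)) - ∑[ c < n G ] (δ b c * (α a + β c))
      ≡⟨ cong₂ _-_ (cong₂ _+_ rowSum (∑-*ˡ 2ℚ (λ c → T a c * β c))) (∑-δˡ b (λ c → α a + β c)) ⟩
    2ℚ * α a + 2ℚ * apply β a - (α a + β b)
      ≡⟨ solve 3 (λ x t y → con 2ℚ :* x :+ con 2ℚ :* t :- (x :+ y) := :- y :+ (x :+ con 2ℚ :* t)) refl (α a) (apply β a) (β b) ⟩
    - β b + (α a + 2ℚ * apply β a) ∎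
    where
    open ≡-Reasoning
    rowSum : ∑[ c < n G ] (2ℚ * α a * T a c) ≡ 2ℚ * α a
    rowSum = trans (∑-*ˡ (2ℚ * α a) (T a)) (trans (cong (2ℚ * α a *_) (transition-rowSum a)) (*-identityʳ (2ℚ * α a)))
    incoming : Fin (n G) → Fin (n G) → ℚ
    incoming c d = if adj G c d then (if eqᶠ b c then 2ℚ * inv (deg G d) - 1ℚ else 2ℚ * inv (deg G d)) * (α d + β c) else 0ℚ
    sift : ∀ c d → (if adj G c d then grover G (a , b) (c , d) * (α d + β c) else 0ℚ) ≡ δ d a * incoming c d
    sift c d with eqᶠ d a
    ... | true = sym (*-identityˡ (incoming c d))
    ... | false = trans (zero-if (adj G c d)) (sym (*-zeroˡ (incoming c d)))
      where
      zero-if : ∀ x → (if x then 0ℚ * (α d + β c) else 0ℚ) ≡ 0ℚ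
      zero-if true = *-zeroˡ (α d + β c)
      zero-if false = refl
    outgoing : ∀ c → incoming c a ≡ 2ℚ * α a * T a c + 2ℚ * (T a c * β c) - δ b c * (α a + β c)
    outgoing c with b ≟ᶠ c
    ... | yes refl rewrite adj-sym G b a | ab =
      solve 3 (λ i x y → (con 2ℚ :* i :- con 1ℚ) :* (x :+ y) := con 2ℚ :* x :* i :+ con 2ℚ :* (i :* y) :- con 1ℚ :* (x :+ y)) refl
        (inv (deg G a)) (α a) (β b)
    ... | no _ rewrite adj-sym G c a with adj G a c
    ...   | true = solve 3 (λ i x y → con 2ℚ :* i :* (x :+ y) := con 2ℚ :* x :* i :+ con 2ℚ :* (i :* y) :- con 0ℚ :* (x :+ y)) refl
                     (inv (deg G a)) (α a) (β c)
    ...   | false = solve 2 (λ x y → con 0ℚ := con 2ℚ :* x :* con 0ℚ :+ con 2ℚ :* (con 0ℚ :* y) :- con 0ℚ :* (x :+ y)) refl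
                      (α a) (β c)

  grover^-▷-liftArc : ∀ m x {a b} → adj G a b ≡ true →
    (powArc G (grover G) m ▷ liftArc x 0ᵥ) (a , b) ≡ liftArc (terminal m x) (origin m x) (a , b)
  grover^-▷-liftArc zero x ab = idArc-▷ (liftArc x 0ᵥ) ab
  grover^-▷-liftArc (suc m) x {a} {b} ab = begin
    (mulArc G (grover G) (powArc G (grover G) m) ▷ liftArc x 0ᵥ) (a , b)
      ≡⟨ mulArc-▷ (grover G) (powArc G (grover G) m) (liftArc x 0ᵥ) (a , b) ⟩
    (grover G ▷ powArc G (grover G) m ▷ liftArc x 0ᵥ) (a , b)
      ≡⟨ sumOver-arcs-cong (λ c d cd → cong (grover G (a , b) (c , d) *_) (grover^-▷-liftArc m x cd)) ⟩
    (grover G ▷ liftArc (terminal m x) (origin m x)) (a , b)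
      ≡⟨ grover-▷-liftArc (terminal m x) (origin m x) ab ⟩
    liftArc (terminal (suc m) x) (origin (suc m) x) (a , b) ∎
    where open ≡-Reasoning

  apply^-nonNeg : ∀ m t u → 0ℚ ≤ apply^ m (basis t) u
  apply^-nonNeg zero t u with eqᶠ u t
  ... | true = from-yes (0ℚ ≤? 1ℚ)
  ... | false = ≤-refl
  apply^-nonNeg (suc m) t u = ∑-nonNeg (λ j → T u j * apply^ m (basis t) j) (λ j → 0≤p*q (transition-nonNeg u j) (apply^-nonNeg m t j))

  walk⇒0<apply^ : ∀ {u t m} → Walk G u t m → 0ℚ < apply^ m (basis t) u
  walk⇒0<apply^ {u} nil rewrite eqᶠ-refl u = from-yes (0ℚ <? 1ℚ)
  walk⇒0<apply^ {u} {t} {suc m} (cons {v = w} uw walk) = begin-strict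
    0ℚ                                        <⟨ 0<p*q (adj⇒0<transition uw) (walk⇒0<apply^ walk) ⟩
    T u w * apply^ m (basis t) w              ≤⟨ term≤∑ (λ j → T u j * apply^ m (basis t) j) (λ j → 0≤p*q (transition-nonNeg u j) (apply^-nonNeg m t j)) w ⟩
    ∑[ j < n G ] (T u j * apply^ m (basis t) j) ∎
    where open ≤-Reasoning

  apply^≢0⇒walk : ∀ m {t} u → apply^ m (basis t) u ≢ 0ℚ → Walk G u t m
  apply^≢0⇒walk zero {t} u δ≢0 with eqᶠ u t in u≟t
  ... | true = subst (λ x → Walk G u x 0) (eqᶠ⇒≡ u≟t) nil
  ... | false = ⊥-elim (δ≢0 refl)
  apply^≢0⇒walk (suc m) {t} u Tw≢0 with ∑≢0⇒∃≢0 (λ j → T u j * apply^ m (basis t) j) Tw≢0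
  ... | j , term≢0 = cons (transition≢0⇒adj Tuj≢0) (apply^≢0⇒walk m j wⱼ≢0)
    where
    Tuj≢0 : T u j ≢ 0ℚ
    Tuj≢0 Tuj≡0 = term≢0 (trans (cong (_* apply^ m (basis t) j) Tuj≡0) (*-zeroˡ (apply^ m (basis t) j)))
    wⱼ≢0 : apply^ m (basis t) j ≢ 0ℚ
    wⱼ≢0 wⱼ≡0 = term≢0 (trans (cong (T u j *_) wⱼ≡0) (*-zeroʳ (T u j)))

  module Period (k : ℕ) (periodic : ∀ e f → IsArc G e → IsArc G f → powArc G (grover G) (suc k) e f ≡ idArc G e f) where

    -- Averaging the identity U^(k+1) (liftArc x 0) = liftArc x 0 over the arcs entering v.
    chebyshev-identity : ∀ x v → terminal (suc k) x v + apply (origin (suc k) x) v ≡ x v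
    chebyshev-identity x v = begin
      tᵥ + apply o v
        ≡⟨ cong (_+ apply o v) (trans (sym (*-identityˡ tᵥ)) (cong (_* tᵥ) (sym (transition-rowSum v)))) ⟩
      ∑[ c < n G ] T v c * tᵥ + apply o v
        ≡⟨ cong (_+ apply o v) (∑-*ʳ tᵥ (T v)) ⟨
      ∑[ c < n G ] (T v c * tᵥ) + apply o v
        ≡⟨ ∑-distrib-+ (λ c → T v c * tᵥ) (λ c → T v c * o c) ⟨
      ∑[ c < n G ] (T v c * tᵥ + T v c * o c)
        ≡⟨ sum-cong-≗ (λ c → trans (sym (*-distribˡ-+ (T v c) tᵥ (o c))) (onArc c)) ⟩
      ∑[ c < n G ] (T v c * x v)
        ≡⟨ ∑-*ʳ (x v) (T v) ⟩
      ∑[ c < n G ] T v c * x v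
        ≡⟨ trans (cong (_* x v) (transition-rowSum v)) (*-identityˡ (x v)) ⟩
      x v ∎
      where
      open ≡-Reasoning
      tᵥ : ℚ
      tᵥ = terminal (suc k) x v
      o : ℚⁿ
      o = origin (suc k) x
      arcIdentity : ∀ {c} → adj G c v ≡ true → tᵥ + o c ≡ x v
      arcIdentity {c} cv = begin
        liftArc (terminal (suc k) x) o (c , v)
          ≡⟨ grover^-▷-liftArc (suc k) x cv ⟨
        (powArc G (grover G) (suc k) ▷ liftArc x 0ᵥ) (c , v)
          ≡⟨ sumOver-arcs-cong (λ c′ d′ c′d′ → cong (_* liftArc x 0ᵥ (c′ , d′)) (periodic (c , v) (c′ , d′) cv c′d′)) ⟩
        (idArc G ▷ liftArc x 0ᵥ) (c , v)
          ≡⟨ idArc-▷ (liftArc x 0ᵥ) cv ⟩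
        x v + 0ℚ
          ≡⟨ +-identityʳ (x v) ⟩
        x v ∎
      onArc : ∀ c → T v c * (tᵥ + o c) ≡ T v c * x v
      onArc c with adj G v c in vc
      ... | true = cong (inv (deg G v) *_) (arcIdentity (trans (adj-sym G c v) vc))
      ... | false = trans (*-zeroˡ (tᵥ + o c)) (sym (*-zeroˡ (x v)))

    periodic-spectrum : ∀ μ z → apply z ≗ μ ·ᵥ z → eval μ rationalCosines ≡ 0ℚ ⊎ z ≗ 0ᵥ
    periodic-spectrum μ z Tz≗μz with chebyshevCoeff μ (suc k) ≟ 1ℚ
    ... | yes C≡1 = inj₁ (lucasV≡2⇒rationalCosines-root μ k (trans (lucasV≡2*chebyshevCoeff μ (suc k)) (cong (2ℚ *_) C≡1)))
    ... | no C≢1 = inj₂ λ v → c*x≡x⇒x≡0 C≢1 (trans (sym (chebyshev-eigen Tz≗μz (suc k) v)) (chebyshev-identity z v))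

    rationalCosines-annihilates : AllEigenvaluesRational T → ∀ t → act rationalCosines (basis t) ≗ 0ᵥ
    rationalCosines-annihilates (μs , χ≈∏) t = annihilate rationalCosines periodic-spectrum μs (basis t)
      (λ v → trans (sym (act-≈P (charPoly T) (prodLinear μs) χ≈∏ (basis t) v)) (cayley-hamilton T t v))
      where open Reversible T (degℚ G) 0<degℚ detailed-balance

    walk⇒walk<5 : AllEigenvaluesRational T → ∀ {u t m} → Walk G u t m → ∃ λ j → j ℕ.< 5 × Walk G u t j
    walk⇒walk<5 rational {u} {t} {m} walk = search (any? λ (j : Fin 5) → ¬? (s (toℕ j) ≟ 0ℚ))
      where
      s : ℕ → ℚ
      s j = apply^ j (basis t) u
      a b : ℚ
      a = ℤ.+ 5 / 4
      b = - (ℤ.+ 1 / 4)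
      recurrence : ∀ j → s (5 ℕ.+ j) ≡ a * s (3 ℕ.+ j) + b * s (1 ℕ.+ j)
      recurrence j = begin
        s (5 ℕ.+ j)
          ≡⟨ solve 6 (λ s₀ s₁ s₂ s₃ s₄ s₅ →
               s₅ := (con 0ℚ :* s₀ :+ (con (- b) :* s₁ :+ (con 0ℚ :* s₂ :+ (con (- a) :* s₃ :+ (con 0ℚ :* s₄ :+ (con 1ℚ :* s₅ :+ con 0ℚ))))))
                     :+ con a :* s₃ :+ con b :* s₁) refl
               (s j) (s (1 ℕ.+ j)) (s (2 ℕ.+ j)) (s (3 ℕ.+ j)) (s (4 ℕ.+ j)) (s (5 ℕ.+ j)) ⟩
        powerSum rationalCosines j (basis t) u + a * s (3 ℕ.+ j) + b * s (1 ℕ.+ j)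
          ≡⟨ cong (λ x → x + a * s (3 ℕ.+ j) + b * s (1 ℕ.+ j)) (trans (sym (act-apply^ rationalCosines j (basis t) u)) (annihilated j u)) ⟩
        0ℚ + a * s (3 ℕ.+ j) + b * s (1 ℕ.+ j)
          ≡⟨ cong (_+ b * s (1 ℕ.+ j)) (+-identityˡ (a * s (3 ℕ.+ j))) ⟩
        a * s (3 ℕ.+ j) + b * s (1 ℕ.+ j) ∎
        where
        open ≡-Reasoning
        annihilated : ∀ j → act rationalCosines (apply^ j (basis t)) ≗ 0ᵥ
        annihilated = act-apply^-annihilated rationalCosines (rationalCosines-annihilates rational t)
      search : Dec (∃ λ (j : Fin 5) → s (toℕ j) ≢ 0ℚ) → ∃ λ j → j ℕ.< 5 × Walk G u t j
      search (yes (j , sⱼ≢0)) = toℕ j , toℕ<n j , apply^≢0⇒walk (toℕ j) u sⱼ≢0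
      search (no ∄j) = ⊥-elim (<⇒≢ (walk⇒0<apply^ walk) (sym (recurrence-vanishing s a b recurrence s<5≡0 m)))
        where
        s<5≡0 : ∀ (j : Fin 5) → s (toℕ j) ≡ 0ℚ
        s<5≡0 j = decidable-stable (s (toℕ j) ≟ 0ℚ) (λ sⱼ≢0 → ∄j (j , sⱼ≢0))

theorem1p2 : (G : Graph) → Connected G → Periodic G →
    AllEigenvaluesRational (transition G) → DiamLessThan G 5
theorem1p2 G connected (k , periodic) rational u v with any? (λ w → deg G w ℕ.≟ 0)
... | yes (w , deg≡0) = 0 , s≤s z≤n , subst (λ x → Walk G x v 0) (trans (trivial v) (sym (trivial u))) nil
  where
  trivial : ∀ x → x ≡ w
  trivial = connected-isolated⇒trivial G connected deg≡0
... | no no-isolated = walk⇒walk<5 rational (proj₂ (connected u v))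
  where
  open Grover G (λ w deg≡0 → no-isolated (w , deg≡0))
  open Period k periodic
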